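{- Let $\alpha,\beta$ be parameters, $n\ge 1$, $x_1,\dots,x_n$ variables and $\lambda$ a partition. Then $$G^{(\alpha,\beta)}_\lambda(x_1,\dots,x_n)=Z_\lambda(x_1,\dots,x_n)=Z^{*}_\lambda(x_1,\dots,x_n),$$ where $Z_\lambda$ and $Z^*_\lambda$ are the lattice partition functions defined in the context.
   Context: Canonical Grothendieck polynomials. For partitions $\mu\subseteq\lambda$, $\lambda/\mu$ is a horizontal strip if $\lambda_1\ge\mu_1\ge\lambda_2\ge\mu_2\ge\cdots$. For a partition $\lambda$ put $\bar\lambda=(\lambda_2,\lambda_3,\dots)$, and for a skew shape $\kappa/\nu$ let $r(\kappa/\nu)$ be the number of indices $i$ with $\kappa_i>\nu_i$. The canonical Grothendieck polynomials $G^{(\alpha,\beta)}_\lambda$ are determined by: with no variables, $G^{(\alpha,\beta)}_\lambda()=1$ if $\lambda=\emptyset$ and $0$ otherwise; and $$G^{(\alpha,\beta)}_\lambda(x_1,\dots,x_{n+1})=\sum_{\mu:\ \lambda/\mu\text{ horizontal strip}}G^{(\alpha,\beta)}_\mu(x_1,\dots,x_n)\Big(\tfrac{x}{1-\alpha x}\Big)^{|\lambda|-|\mu|}\Big(\tfrac{1+\beta x}{1-\alpha x}\Big)^{r(\mu/\bar\lambda)},\quad x=x_{n+1}.$$ Lattice conventions. A vertex has left label $a$, bottom label $b$, right label $c$, top label $d$; its weight is $0$ unless $a+b=c+d$. A row with parameter $x$ is a sequence of vertices at sites $j=1,2,3,\dots$, the right label at site $j$ being the left label at site $j+1$; vertical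 labels are nonnegative integers; the left label at site $1$ (left boundary) is free, i.e. summed over all allowed values, and the right labels must be eventually equal to a prescribed right boundary value. A stack of rows $1,\dots,n$ (numbered from bottom to top) identifies the top labels of row $k$ with the bottom labels of row $k+1$; the bottom labels of row $1$ and the top labels of row $n$ are prescribed. The partition function is the sum over all labelings of the non-prescribed edges of the product of the vertex weights (all but finitely many vertices have weight $1$). For a partition $\lambda$ let $m_j(\lambda)$ be the number of parts of $\lambda$ equal to $j$. $Z_\lambda(x_1,\dots,x_n)$: horizontal labels in $\{0,1\}$; weights $w_x(a,b;c,d)=1$ if $a=b=c=d=0$; $=\frac{x}{1-\alpha x}$ if $a=1$; $=\frac{1+\beta x}{1-\alpha x}$ if $a=0$ and $(b,c,d)\neq(0,0,0)$ (subject to conservation); row $k$ has parameter $x_k$; bottom boundary all $0$; top boundary $(m_j(\lambda))_{j\ge1}$; right boundary value $0$. $Z^*_\lambda(x_1,\dots,x_n)$: horizontal labels in $\{0,1\}$; weights $w^*_x(a,b;c,d)=1$ if $(a,b,c,d)=(1,0,1,0)$; $=\frac{1+\beta x}{1-\alpha x}$ if $a=1$ and $(b,c,d)\ne(0,1,0)$; $=\frac{x}{1-\alpha x}$ if $a=0$ (subject to conservation); row $k$ (from the bottom) has parameter $x_{n+1-k}$; bottom boundary $(m_j(\lambda))_{j\ge1}$; top boundary all $0$; right boundary value $1$. -}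

module Defs where

open import Algebra.Bundles using (CommutativeRing)
open import Data.Nat using (ℕ; zero; suc; _+_; _∸_; _≤ᵇ_; _≡ᵇ_; _<ᵇ_)
open import Data.Bool using (Bool; true; false; _∧_; if_then_else_)
open import Data.List using (List; []; _∷_; length; map; concatMap; filter; foldr; reverse; allFin; drop; upTo)
open import Data.Nat.ListAction using (sum)
open import Data.Vec using (Vec; []; _∷_; replicate; tabulate)
open import Data.Fin using (Fin; toℕ; inject₁; fromℕ)
open import Data.Product using (_×_; _,_; proj₁; proj₂)
open import Function using (_∘_)

isPartition : List ℕ → Bool
isPartition [] = true
isPartition (a ∷ []) = 1 ≤ᵇ a
isPartition (a ∷ b ∷ l) = (b ≤ᵇ a) ∧ isPartition (b ∷ l)

-- i-th part (0-indexed), 0 beyond the length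
part : List ℕ → ℕ → ℕ
part [] _ = 0
part (a ∷ l) zero = a
part (a ∷ l) (suc i) = part l i

firstPart : List ℕ → ℕ
firstPart l = part l 0

allBelow : ℕ → (ℕ → Bool) → Bool
allBelow zero p = true
allBelow (suc k) p = allBelow k p ∧ p k

countBelow : ℕ → (ℕ → Bool) → ℕ
countBelow zero p = 0
countBelow (suc k) p = countBelow k p + (if p k then 1 else 0)

-- la/mu is a horizontal strip: la_i ≥ mu_i ≥ la_{i+1} for all i
-- (for i ≥ length la + length mu all the parts involved are 0)
isHStrip : List ℕ → List ℕ → Bool
isHStrip la mu = allBelow (length la + length mu)
  (λ i → (part mu i ≤ᵇ part la i) ∧ (part la (suc i) ≤ᵇ part mu i))

-- r(κ/ν) = #{ i : κ_i > ν_i }  (only i < length κ can contribute)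
r : List ℕ → List ℕ → ℕ
r κ ν = countBelow (length κ) (λ i → part ν i <ᵇ part κ i)

bar : List ℕ → List ℕ
bar = drop 1

listsOfLen : ℕ → ℕ → List (List ℕ)
listsOfLen M zero = [] ∷ []
listsOfLen M (suc k) = concatMap (λ l → map (λ a → a ∷ l) (upTo (suc M))) (listsOfLen M k)

listsUpTo : ℕ → ℕ → List (List ℕ)
listsUpTo M k = concatMap (listsOfLen M) (upTo (suc k))

-- all partitions mu with la/mu a horizontal strip (each exactly once):
-- such mu satisfy mu ⊆ la, hence length mu ≤ length la and mu_1 ≤ la_1.
strips : List ℕ → List (List ℕ)
strips la = filter (λ mu → Data.Bool.T? (isPartition mu ∧ isHStrip la mu))
                   (listsUpTo (firstPart la) (length la))
  where import Data.Bool

-- m_j(λ) for j = 1..N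
mult : List ℕ → (N : ℕ) → Vec ℕ N
mult la N = tabulate (λ (j : Fin N) → foldr (λ p acc → (if p ≡ᵇ suc (toℕ j) then 1 else 0) + acc) 0 la)

bits : (N : ℕ) → List (Vec ℕ N)
bits zero = [] ∷ []
bits (suc N) = concatMap (λ v → (0 ∷ v) ∷ (1 ∷ v) ∷ []) (bits N)

headOr : ∀ {N} → ℕ → Vec ℕ N → ℕ
headOr d [] = d
headOr d (a ∷ _) = a

vecEq : ∀ {N} → Vec ℕ N → Vec ℕ N → Bool
vecEq [] [] = true
vecEq (a ∷ u) (b ∷ v) = (a ≡ᵇ b) ∧ vecEq u v

-- Everything algebraic lives over an arbitrary commutative ring R;
-- 1/(1-αx) is represented by a given inverse u with (1-αx)u ≈ 1.

module _ {c ℓ} (R : CommutativeRing c ℓ) where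
  open CommutativeRing R renaming (_+_ to _+R_; _*_ to _*R_)

  sumR : List Carrier → Carrier
  sumR = foldr _+R_ 0#

  pow : Carrier → ℕ → Carrier
  pow x zero = 1#
  pow x (suc k) = x *R pow x k

  -- x/(1-αx) and (1+βx)/(1-αx), given u = 1/(1-αx)
  fracA : Carrier → Carrier → Carrier
  fracA x u = x *R u

  fracB : Carrier → Carrier → Carrier → Carrier
  fracB β x u = (1# +R β *R x) *R u

  G : Carrier → (n : ℕ) → (xs us : Fin n → Carrier) → List ℕ → Carrier
  G β zero xs us la with la
  ... | [] = 1#
  ... | _ ∷ _ = 0#
  G β (suc n) xs us la =
    sumR (map (λ mu → G β n (xs ∘ inject₁) (us ∘ inject₁) mu
                      *R (pow (fracA x u) (sum la ∸ sum mu)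
                      *R pow (fracB β x u) (r mu (bar la))))
              (strips la))
    where
      x = xs (fromℕ n)
      u = us (fromℕ n)

  -- Lattice models
  -- vertex weight as a function of (a,b,c,d) = (left,bottom,right,top)
  Weight : Set c
  Weight = ℕ → ℕ → ℕ → ℕ → Carrier

  wZ : Carrier → Carrier → Weight
  wZ A B a b c d with (a + b) ≡ᵇ (c + d)
  ... | false = 0#
  ... | true with a | b | c | d
  ...   | 0 | 0 | 0 | 0 = 1#
  ...   | 1 | _ | _ | _ = A
  ...   | 0 | _ | _ | _ = B
  ...   | _ | _ | _ | _ = 0#

  wZ* : Carrier → Carrier → Weight
  wZ* A B a b c d with (a + b) ≡ᵇ (c + d)
  ... | false = 0#
  ... | true with a | b | c | d
  ...   | 1 | 0 | 1 | 0 = 1#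
  ...   | 1 | _ | _ | _ = B
  ...   | 0 | _ | _ | _ = A
  ...   | _ | _ | _ | _ = 0#

  -- One row on sites 1..N.  'as' = left labels at sites 1..N (the right
  -- label at site j is the left label at site j+1; at site N it is the
  -- right boundary value rb), 'bs' = bottom labels.  The top label at each
  -- vertex is forced by conservation, d = a+b-c (if a+b < c the weight
  -- vanishes for every d, and is correctly computed as 0).
  row : Weight → ℕ → ∀ {N} → Vec ℕ N → Vec ℕ N → Carrier × Vec ℕ N
  row w rb [] [] = 1# , []
  row w rb (a ∷ as) (b ∷ bs) =
    let cc = headOr rb as
        d  = (a + b) ∸ cc
        rest = row w rb as bs
    in w a b cc d *R proj₁ rest , d ∷ proj₂ rest

  -- partition function of a stack of rows (listed bottom to top),
  -- bottom labels 'bot', prescribed top labels 'top', right boundary rb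
  stack : List Weight → ℕ → ∀ {N} → Vec ℕ N → Vec ℕ N → Carrier
  stack [] rb bot top = if vecEq bot top then 1# else 0#
  stack (w ∷ ws) rb {N} bot top =
    sumR (map (λ as → proj₁ (row w rb as bot) *R stack ws rb (proj₂ (row w rb as bot)) top)
              (bits N))

  Z : Carrier → (n : ℕ) → (xs us : Fin n → Carrier) → (N : ℕ) → List ℕ → Carrier
  Z β n xs us N la =
    stack (map (λ i → wZ (fracA (xs i) (us i)) (fracB β (xs i) (us i))) (allFin n))
          0 (replicate N 0) (mult la N)

  Z* : Carrier → (n : ℕ) → (xs us : Fin n → Carrier) → (N : ℕ) → List ℕ → Carrier
  Z* β n xs us N la =
    stack (map (λ i → wZ* (fracA (xs i) (us i)) (fracB β (xs i) (us i))) (reverse (allFin n)))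
          1 (mult la N) (replicate N 0)

-- Encode a partition λ with λ₁ ≤ N by its multiplicity vector (m₁(λ), …, m_N(λ)),
-- the vertical labels of both lattices.  Read column by column, a row of Z with
-- parameter x is a transfer matrix whose entry from μ to λ is the branching
-- coefficient (x/(1−αx))^{|λ|−|μ|} ((1+βx)/(1−αx))^{r(μ/λ̄)} of G if λ/μ is a
-- horizontal strip and 0 otherwise: the horizontal label entering column j is
-- λ′ⱼ − μ′ⱼ = #{i : λᵢ ≥ j} − #{i : μᵢ ≥ j}, and this stays in {0,1} exactly for
-- horizontal strips.  A row of Z* is the same matrix read from λ down to μ, with
-- complemented horizontal labels.  Peeling off the top row of Z, respectively the
-- bottom row of Z*, both with parameter xₙ, turns either partition function into
-- the branching rule of G, so both agree with G by induction on n.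

module Submission where

open import Defs
open import Algebra.Bundles using (CommutativeRing)
open import Data.Nat using (ℕ; _≤_)
open import Data.Fin using (Fin)
open import Data.List using (List)
open import Data.Bool using (T; true)
open import Data.Product using (_×_; _,_)
open import Relation.Binary.PropositionalEquality using (_≡_)

module Partitions where

  open import Data.Nat using (ℕ; zero; suc; _+_; _∸_; _≤ᵇ_; _≡ᵇ_; _<ᵇ_; _≤_; z≤n; s≤s)
  open import Data.Nat.Properties
  open import Data.Nat.ListAction using (sum)
  open import Data.Nat.ListAction.Properties using (sum-++)
  open import Data.Nat.Tactic.RingSolver using (solve-∀)
  open import Data.Bool using (Bool; true; false; _∧_; if_then_else_; T)
  open import Data.Bool.Properties using (∧-assoc)
  open import Data.List using (List; []; _∷_; length; map; _++_; _∷ʳ_; replicate; drop; foldr; concatMap; upTo; tabulate; allFin; reverse)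
  open import Data.List.Properties using (length-map; length-++; length-replicate; length-drop; drop-[]; map-tabulate; reverse-map; reverse-++)
  open import Data.List.Relation.Unary.All using (All; []; _∷_)
  import Data.List.Relation.Unary.All as All
  open import Data.List.Relation.Unary.All.Properties using (map⁺; ++⁺; drop⁺; replicate⁺)
  open import Data.Vec using (Vec; []; _∷_)
  import Data.Vec as Vec
  import Data.Vec.Properties as Vec
  open import Data.Vec.Relation.Binary.Pointwise.Inductive using (Pointwise; []; _∷_)
  open import Data.Fin using (Fin; toℕ; inject₁; fromℕ)
  open import Data.Product using (_×_; _,_; proj₁; proj₂; ∃)
  open import Data.Empty using (⊥-elim)
  open import Relation.Binary.PropositionalEquality
  open import Function using (_∘_; id)

  ∧-trueˡ : ∀ {x y} → (x ∧ y) ≡ true → x ≡ true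
  ∧-trueˡ {true} _ = refl

  ∧-trueʳ : ∀ {x y} → (x ∧ y) ≡ true → y ≡ true
  ∧-trueʳ {true} e = e

  T⇒≡true : ∀ {b} → T b → b ≡ true
  T⇒≡true {true} _ = refl

  ≤ᵇ-true⇒≤ : ∀ {m n} → (m ≤ᵇ n) ≡ true → m ≤ n
  ≤ᵇ-true⇒≤ {m} {n} e = ≤ᵇ⇒≤ m n (subst T (sym e) _)

  ≤⇒≤ᵇ-true : ∀ {m n} → m ≤ n → (m ≤ᵇ n) ≡ true
  ≤⇒≤ᵇ-true = T⇒≡true ∘ ≤⇒≤ᵇ

  suc≤ᵇsuc : ∀ m n → (suc m ≤ᵇ suc n) ≡ (m ≤ᵇ n)
  suc≤ᵇsuc zero    n = refl
  suc≤ᵇsuc (suc m) n = refl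

  ≡ᵇ-refl : ∀ n → (n ≡ᵇ n) ≡ true
  ≡ᵇ-refl zero    = refl
  ≡ᵇ-refl (suc n) = ≡ᵇ-refl n

  ≡ᵇ-true⇒≡ : ∀ m n → (m ≡ᵇ n) ≡ true → m ≡ n
  ≡ᵇ-true⇒≡ m n e = ≡ᵇ⇒≡ m n (subst T (sym e) _)

  ≡ᵇ-sym : ∀ a b → (a ≡ᵇ b) ≡ (b ≡ᵇ a)
  ≡ᵇ-sym zero    zero    = refl
  ≡ᵇ-sym zero    (suc b) = refl
  ≡ᵇ-sym (suc a) zero    = refl
  ≡ᵇ-sym (suc a) (suc b) = ≡ᵇ-sym a b

  ≢⇒≡ᵇ-false : ∀ m n → m ≢ n → (m ≡ᵇ n) ≡ false
  ≢⇒≡ᵇ-false m n m≢n with m ≡ᵇ n in eq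
  ... | true  = ⊥-elim (m≢n (≡ᵇ-true⇒≡ m n eq))
  ... | false = refl

  listEq : List ℕ → List ℕ → Bool
  listEq []      []      = true
  listEq (a ∷ x) (b ∷ y) = (a ≡ᵇ b) ∧ listEq x y
  listEq []      (_ ∷ _) = false
  listEq (_ ∷ _) []      = false

  listEq-true⇒≡ : ∀ x y → listEq x y ≡ true → x ≡ y
  listEq-true⇒≡ []      []      e = refl
  listEq-true⇒≡ (a ∷ x) (b ∷ y) e =
    cong₂ _∷_ (≡ᵇ-true⇒≡ a b (∧-trueˡ {a ≡ᵇ b} e)) (listEq-true⇒≡ x y (∧-trueʳ {a ≡ᵇ b} e))

  listEq-refl : ∀ x → listEq x x ≡ true
  listEq-refl []      = refl
  listEq-refl (a ∷ x) rewrite ≡ᵇ-refl a = listEq-refl x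

  vecEq-true⇒≡ : ∀ {N} (x y : Vec ℕ N) → vecEq x y ≡ true → x ≡ y
  vecEq-true⇒≡ []      []      e = refl
  vecEq-true⇒≡ (a ∷ x) (b ∷ y) e =
    cong₂ _∷_ (≡ᵇ-true⇒≡ a b (∧-trueˡ {a ≡ᵇ b} e)) (vecEq-true⇒≡ x y (∧-trueʳ {a ≡ᵇ b} e))

  vecEq-refl : ∀ {N} (x : Vec ℕ N) → vecEq x x ≡ true
  vecEq-refl []      = refl
  vecEq-refl (a ∷ x) rewrite ≡ᵇ-refl a = vecEq-refl x

  vecEq-sym : ∀ {N} (x y : Vec ℕ N) → vecEq x y ≡ vecEq y x
  vecEq-sym []      []      = refl
  vecEq-sym (a ∷ x) (b ∷ y) = cong₂ _∧_ (≡ᵇ-sym a b) (vecEq-sym x y)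

  -- Partitions and their multiplicity vectors

  Positive : List ℕ → Set
  Positive = All (1 ≤_)

  ones : ℕ → List ℕ
  ones a = replicate a 1

  -- If L has multiplicity vector v, then bump a L has multiplicity vector a ∷ v.
  bump : ℕ → List ℕ → List ℕ
  bump a L = map suc L ++ ones a

  fromMult : ∀ {N} → Vec ℕ N → List ℕ
  fromMult []      = []
  fromMult (a ∷ v) = bump a (fromMult v)

  positive-bump : ∀ a L → Positive (bump a L)
  positive-bump a L = ++⁺ (map⁺ (All.universal (λ _ → s≤s z≤n) L)) (replicate⁺ a (s≤s z≤n))

  positive-fromMult : ∀ {N} (v : Vec ℕ N) → Positive (fromMult v)
  positive-fromMult []      = []
  positive-fromMult (a ∷ v) = positive-bump a (fromMult v)

  bar-bump : ∀ L a → ∃ λ c → bar (bump a L) ≡ bump c (bar L)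
  bar-bump []      zero    = 0 , refl
  bar-bump []      (suc a) = a , refl
  bar-bump (x ∷ L) a       = a , refl

  length-bump : ∀ L a → length (bump a L) ≡ length L + a
  length-bump L a rewrite length-++ (map suc L) {ones a} | length-map suc L | length-replicate a {1} = refl

  isPartition⇒positive : ∀ L → isPartition L ≡ true → Positive L
  isPartition⇒positive []          e = []
  isPartition⇒positive (a ∷ [])    e = ≤ᵇ-true⇒≤ e ∷ []
  isPartition⇒positive (a ∷ b ∷ L) e with isPartition⇒positive (b ∷ L) (∧-trueʳ {b ≤ᵇ a} e)
  ... | 1≤b ∷ p = ≤-trans 1≤b (≤ᵇ-true⇒≤ (∧-trueˡ {b ≤ᵇ a} e)) ∷ (1≤b ∷ p)

  isPartition-bar : ∀ x l → isPartition (x ∷ l) ≡ true → isPartition l ≡ true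
  isPartition-bar x []      e = refl
  isPartition-bar x (y ∷ l) e = ∧-trueʳ {y ≤ᵇ x} e

  isPartition⇒head≥ : ∀ x l → isPartition (x ∷ l) ≡ true → part l 0 ≤ x
  isPartition⇒head≥ x []      e = z≤n
  isPartition⇒head≥ x (y ∷ l) e = ≤ᵇ-true⇒≤ (∧-trueˡ {y ≤ᵇ x} e)

  isPartition-ones : ∀ a → isPartition (ones a) ≡ true
  isPartition-ones zero          = refl
  isPartition-ones (suc zero)    = refl
  isPartition-ones (suc (suc a)) = isPartition-ones (suc a)

  isPartition-bump : ∀ L a → isPartition L ≡ true → isPartition (bump a L) ≡ true
  isPartition-bump []           a       e = isPartition-ones a
  isPartition-bump (l ∷ [])     zero    e = refl
  isPartition-bump (l ∷ [])     (suc a) e = isPartition-ones (suc a)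
  isPartition-bump (l ∷ l' ∷ L) a       e =
    cong₂ _∧_ (trans (suc≤ᵇsuc l' l) (∧-trueˡ {l' ≤ᵇ l} e)) (isPartition-bump (l' ∷ L) a (∧-trueʳ {l' ≤ᵇ l} e))

  isPartition-fromMult : ∀ {N} (v : Vec ℕ N) → isPartition (fromMult v) ≡ true
  isPartition-fromMult []      = refl
  isPartition-fromMult (a ∷ v) = isPartition-bump (fromMult v) a (isPartition-fromMult v)

  count : ℕ → List ℕ → ℕ
  count j = foldr (λ p acc → (if p ≡ᵇ j then 1 else 0) + acc) 0

  count-++ : ∀ j xs ys → count j (xs ++ ys) ≡ count j xs + count j ys
  count-++ j []       ys = refl
  count-++ j (x ∷ xs) ys rewrite count-++ j xs ys = sym (+-assoc (if x ≡ᵇ j then 1 else 0) _ _)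

  count1-map-suc : ∀ {X} → Positive X → count 1 (map suc X) ≡ 0
  count1-map-suc []             = refl
  count1-map-suc (s≤s z≤n ∷ p) = count1-map-suc p

  count1-ones : ∀ a → count 1 (ones a) ≡ a
  count1-ones zero    = refl
  count1-ones (suc a) = cong suc (count1-ones a)

  count-suc-map-suc : ∀ j X → count (suc j) (map suc X) ≡ count j X
  count-suc-map-suc j []      = refl
  count-suc-map-suc j (x ∷ X) = cong ((if x ≡ᵇ j then 1 else 0) +_) (count-suc-map-suc j X)

  count2+-ones : ∀ j a → count (suc (suc j)) (ones a) ≡ 0
  count2+-ones j zero    = refl
  count2+-ones j (suc a) = count2+-ones j a

  mult-fromMult : ∀ {N} (v : Vec ℕ N) → mult (fromMult v) N ≡ v
  mult-fromMult []             = refl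
  mult-fromMult {suc N} (a ∷ v) = cong₂ _∷_ first (trans (Vec.tabulate-cong rest) (mult-fromMult v))
    where
      first : count 1 (bump a (fromMult v)) ≡ a
      first rewrite count-++ 1 (map suc (fromMult v)) (ones a)
                  | count1-map-suc (positive-fromMult v) | count1-ones a = refl
      rest : ∀ (j : Fin N) → count (suc (suc (toℕ j))) (bump a (fromMult v)) ≡ count (suc (toℕ j)) (fromMult v)
      rest j rewrite count-++ (suc (suc (toℕ j))) (map suc (fromMult v)) (ones a) | count2+-ones (toℕ j) a
                   | count-suc-map-suc (suc (toℕ j)) (fromMult v) = +-identityʳ _

  unbump : List ℕ → List ℕ
  unbump []                = []
  unbump (zero ∷ l)        = unbump l
  unbump (suc zero ∷ l)    = unbump l
  unbump (suc (suc x) ∷ l) = suc x ∷ unbump l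

  count-unbump : ∀ j L → count (suc j) (unbump L) ≡ count (suc (suc j)) L
  count-unbump j []                = refl
  count-unbump j (zero ∷ l)        = count-unbump j l
  count-unbump j (suc zero ∷ l)    = count-unbump j l
  count-unbump j (suc (suc x) ∷ l) = cong ((if x ≡ᵇ j then 1 else 0) +_) (count-unbump j l)

  unbump-small : ∀ x l → isPartition (x ∷ l) ≡ true → x ≤ 1 → unbump (x ∷ l) ≡ []
  unbump-small zero          []      e le = refl
  unbump-small (suc zero)    []      e le = refl
  unbump-small (suc (suc x)) l       e (s≤s ())
  unbump-small zero          (y ∷ l) e le =
    unbump-small y l (isPartition-bar 0 (y ∷ l) e) (≤-trans (isPartition⇒head≥ 0 (y ∷ l) e) le)
  unbump-small (suc zero)    (y ∷ l) e le =
    unbump-small y l (isPartition-bar 1 (y ∷ l) e) (≤-trans (isPartition⇒head≥ 1 (y ∷ l) e) le)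

  bump-unbump : ∀ L → isPartition L ≡ true → bump (count 1 L) (unbump L) ≡ L
  bump-unbump [] e = refl
  bump-unbump (zero ∷ l) e with isPartition⇒positive (zero ∷ l) e
  ... | () ∷ _
  bump-unbump (suc zero ∷ l) e rewrite unbump-small 1 l e (s≤s z≤n) =
    cong (1 ∷_) (trans (cong (λ z → bump (count 1 l) z) (sym (unbump-small 1 l e (s≤s z≤n))))
                       (bump-unbump l (isPartition-bar 1 l e)))
  bump-unbump (suc (suc y) ∷ l) e = cong (suc (suc y) ∷_) (bump-unbump l (isPartition-bar _ l e))

  isPartition-unbump : ∀ L → isPartition L ≡ true →
                       (isPartition (unbump L) ≡ true) × (part (unbump L) 0 ≤ part L 0 ∸ 1)
  isPartition-unbump [] e = refl , z≤n
  isPartition-unbump (zero ∷ l) e with isPartition⇒positive (zero ∷ l) e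
  ... | () ∷ _
  isPartition-unbump (suc zero ∷ l) e rewrite unbump-small 1 l e (s≤s z≤n) = refl , z≤n
  isPartition-unbump (suc (suc y) ∷ l) e
    with unbump l | isPartition-unbump l (isPartition-bar _ l e)
  ... | []       | _           = refl , ≤-refl
  ... | w ∷ rest | isP , first =
    cong₂ _∧_ (≤⇒≤ᵇ-true (≤-trans first (∸-monoˡ-≤ 1 (isPartition⇒head≥ _ l e)))) isP , ≤-refl

  fromMult-mult : ∀ N L → isPartition L ≡ true → part L 0 ≤ N → fromMult (mult L N) ≡ L
  fromMult-mult zero [] e le = refl
  fromMult-mult zero (x ∷ L) e le with isPartition⇒positive (x ∷ L) e
  ... | 1≤x ∷ _ = ⊥-elim (<⇒≱ 1≤x le)
  fromMult-mult (suc N) L e le = begin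
      bump (count 1 L) (fromMult (Vec.tabulate {n = N} (λ j → count (suc (suc (toℕ j))) L)))
    ≡⟨ cong (λ (z : Vec ℕ N) → bump (count 1 L) (fromMult z)) (sym (Vec.tabulate-cong (λ j → count-unbump (toℕ j) L))) ⟩
      bump (count 1 L) (fromMult (mult (unbump L) N))
    ≡⟨ cong (bump (count 1 L)) (fromMult-mult N (unbump L) isP (≤-trans first (∸-monoˡ-≤ 1 le))) ⟩
      bump (count 1 L) (unbump L)
    ≡⟨ bump-unbump L e ⟩
      L
    ∎ where
      open ≡-Reasoning
      isP : isPartition (unbump L) ≡ true
      isP = proj₁ (isPartition-unbump L e)
      first : part (unbump L) 0 ≤ part L 0 ∸ 1
      first = proj₂ (isPartition-unbump L e)

  fromMult-replicate-0 : ∀ N → fromMult (Vec.replicate N 0) ≡ []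
  fromMult-replicate-0 zero    = refl
  fromMult-replicate-0 (suc N) rewrite fromMult-replicate-0 N = refl

  vecEq-mult-[] : ∀ N → vecEq (mult [] N) (Vec.replicate N 0) ≡ true
  vecEq-mult-[] zero    = refl
  vecEq-mult-[] (suc N) = vecEq-mult-[] N

  -- Horizontal strips

  interlacesAt : List ℕ → List ℕ → ℕ → Bool
  interlacesAt la mu i = (part mu i ≤ᵇ part la i) ∧ (part la (suc i) ≤ᵇ part mu i)

  isHStripᵣ : List ℕ → List ℕ → Bool
  isHStripᵣ []           []       = true
  isHStripᵣ la@(_ ∷ L)   []       = interlacesAt la [] 0 ∧ isHStripᵣ L []
  isHStripᵣ []           mu@(_ ∷ M) = interlacesAt [] mu 0 ∧ isHStripᵣ [] M
  isHStripᵣ la@(_ ∷ L)   mu@(_ ∷ M) = interlacesAt la mu 0 ∧ isHStripᵣ L M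

  part-bar : ∀ l i → part l (suc i) ≡ part (bar l) i
  part-bar []      i = refl
  part-bar (x ∷ l) i = refl

  interlacesAt-suc : ∀ la mu i → interlacesAt la mu (suc i) ≡ interlacesAt (bar la) (bar mu) i
  interlacesAt-suc la mu i
    rewrite part-bar la i | part-bar mu i | part-bar la (suc i) | part-bar (bar la) i = refl

  allBelow-suc : ∀ k p → allBelow (suc k) p ≡ (p 0 ∧ allBelow k (p ∘ suc))
  allBelow-suc zero    p with p 0
  ... | true  = refl
  ... | false = refl
  allBelow-suc (suc k) p = trans (cong (_∧ p (suc k)) (allBelow-suc k p)) (∧-assoc (p 0) _ _)

  allBelow-cong : ∀ k {p q : ℕ → Bool} → (∀ i → p i ≡ q i) → allBelow k p ≡ allBelow k q
  allBelow-cong zero    e = refl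
  allBelow-cong (suc k) e = cong₂ _∧_ (allBelow-cong k e) (e k)

  allBelow-true : ∀ k {p} → (∀ i → p i ≡ true) → allBelow k p ≡ true
  allBelow-true zero    e = refl
  allBelow-true (suc k) e rewrite allBelow-true k e | e k = refl

  isHStripᵣ-unfold : ∀ la mu → isHStripᵣ la mu ≡ (interlacesAt la mu 0 ∧ isHStripᵣ (bar la) (bar mu))
  isHStripᵣ-unfold []      []      = refl
  isHStripᵣ-unfold (_ ∷ _) []      = refl
  isHStripᵣ-unfold []      (_ ∷ _) = refl
  isHStripᵣ-unfold (_ ∷ _) (_ ∷ _) = refl

  length-bars : ∀ la mu k → length la + length mu ≤ suc k → length (bar la) + length (bar mu) ≤ k
  length-bars []      []      k le       = z≤n
  length-bars (_ ∷ L) []      k (s≤s le) = le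
  length-bars []      (_ ∷ M) k (s≤s le) = le
  length-bars (_ ∷ L) (_ ∷ M) k (s≤s le) = ≤-trans (≤-trans (n≤1+n _) (≤-reflexive (sym (+-suc _ _)))) le

  allBelow-interlaces : ∀ la mu k → length la + length mu ≤ k →
                        allBelow k (interlacesAt la mu) ≡ isHStripᵣ la mu
  allBelow-interlaces [] [] zero _ = refl
  allBelow-interlaces la mu (suc k) le = begin
      allBelow (suc k) (interlacesAt la mu)
    ≡⟨ allBelow-suc k (interlacesAt la mu) ⟩
      interlacesAt la mu 0 ∧ allBelow k (interlacesAt la mu ∘ suc)
    ≡⟨ cong (interlacesAt la mu 0 ∧_) (allBelow-cong k (interlacesAt-suc la mu)) ⟩
      interlacesAt la mu 0 ∧ allBelow k (interlacesAt (bar la) (bar mu))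
    ≡⟨ cong (interlacesAt la mu 0 ∧_) (allBelow-interlaces (bar la) (bar mu) k (length-bars la mu k le)) ⟩
      interlacesAt la mu 0 ∧ isHStripᵣ (bar la) (bar mu)
    ≡⟨ sym (isHStripᵣ-unfold la mu) ⟩
      isHStripᵣ la mu
    ∎ where open ≡-Reasoning

  isHStrip≡isHStripᵣ : ∀ la mu → isHStrip la mu ≡ isHStripᵣ la mu
  isHStrip≡isHStripᵣ la mu = allBelow-interlaces la mu _ ≤-refl

  part-ones≤ᵇ1 : ∀ a → (part (ones a) 0 ≤ᵇ 1) ≡ true
  part-ones≤ᵇ1 zero    = refl
  part-ones≤ᵇ1 (suc a) = refl

  isHStripᵣ-ones : ∀ a b → isHStripᵣ (ones a) (ones b) ≡ ((b ≤ᵇ a) ∧ (a ≤ᵇ suc b))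
  isHStripᵣ-ones zero          zero    = refl
  isHStripᵣ-ones zero          (suc b) = refl
  isHStripᵣ-ones (suc zero)    zero    = refl
  isHStripᵣ-ones (suc (suc a)) zero    = refl
  isHStripᵣ-ones (suc a)       (suc b)
    rewrite part-ones≤ᵇ1 a | isHStripᵣ-ones a b | suc≤ᵇsuc b a | suc≤ᵇsuc a (suc b) = refl

  part-bump≤ᵇ : ∀ L a m → (part (bump a L) 0 ≤ᵇ suc m) ≡ (part L 0 ≤ᵇ m)
  part-bump≤ᵇ []      zero    m = refl
  part-bump≤ᵇ []      (suc a) m = refl
  part-bump≤ᵇ (x ∷ L) a       m = suc≤ᵇsuc x m

  columnInterlaces : List ℕ → List ℕ → ℕ → ℕ → Bool
  columnInterlaces L M a b = (length M + b ≤ᵇ length L + a) ∧ (length L + a ≤ᵇ suc (length M + b))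

  isHStripᵣ-bump : ∀ {L M} → Positive L → Positive M → ∀ a b →
                   isHStripᵣ (bump a L) (bump b M) ≡ (isHStripᵣ L M ∧ columnInterlaces L M a b)
  isHStripᵣ-bump [] [] a b = isHStripᵣ-ones a b
  isHStripᵣ-bump {l ∷ L'} {m ∷ M'} (_ ∷ pL) (_ ∷ pM) a b
    rewrite suc≤ᵇsuc m l | part-bump≤ᵇ L' a m | isHStripᵣ-bump pL pM a b
          | suc≤ᵇsuc (length M' + b) (length L' + a) | suc≤ᵇsuc (length L' + a) (suc (length M' + b))
    = sym (∧-assoc ((m ≤ᵇ l) ∧ (part L' 0 ≤ᵇ m)) (isHStripᵣ L' M') _)
  isHStripᵣ-bump {_ ∷ []}           (_ ∷ [])           [] zero    zero    = refl
  isHStripᵣ-bump {_ ∷ []}           (_ ∷ [])           [] (suc a) zero    = refl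
  isHStripᵣ-bump {_ ∷ (suc _ ∷ _)}  (_ ∷ (s≤s z≤n ∷ _)) [] a       zero    = refl
  isHStripᵣ-bump {_ ∷ []}           (_ ∷ [])           [] a       (suc b)
    rewrite part-ones≤ᵇ1 a | isHStripᵣ-ones a b | suc≤ᵇsuc b a | suc≤ᵇsuc a (suc b) = refl
  isHStripᵣ-bump {_ ∷ (suc _ ∷ _)}  (_ ∷ (s≤s z≤n ∷ _)) [] a       (suc b) = refl
  isHStripᵣ-bump {[]} {suc _ ∷ _}   [] (s≤s z≤n ∷ _) zero    b = refl
  isHStripᵣ-bump {[]} {suc _ ∷ _}   [] (s≤s z≤n ∷ _) (suc a) b = refl

  isHStripᵣ⇒length : ∀ {L M} → isHStripᵣ L M ≡ true → Positive L → Positive M →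
                     ∃ λ j → j ≤ 1 × length L ≡ length M + j
  isHStripᵣ⇒length {[]}            {[]}        _ _ _ = 0 , z≤n , refl
  isHStripᵣ⇒length {_ ∷ []}        {[]}        _ _ _ = 1 , s≤s z≤n , refl
  isHStripᵣ⇒length {_ ∷ suc _ ∷ _} {[]}        () _ _
  isHStripᵣ⇒length {[]}            {suc _ ∷ _} () _ _
  isHStripᵣ⇒length {[]}            {zero ∷ _}  _ _ (() ∷ _)
  isHStripᵣ⇒length {_ ∷ zero ∷ _}  {[]}        _ (_ ∷ (() ∷ _)) _
  isHStripᵣ⇒length {_ ∷ _} {_ ∷ _} e (_ ∷ pL) (_ ∷ pM) with isHStripᵣ⇒length (∧-trueʳ e) pL pM
  ... | j , j≤1 , eq = j , j≤1 , cong suc eq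

  isHStripᵣ⇒sum≤ : ∀ L M → isHStripᵣ L M ≡ true → sum M ≤ sum L
  isHStripᵣ⇒sum≤ []      []           e = ≤-refl
  isHStripᵣ⇒sum≤ (_ ∷ _) []           e = z≤n
  isHStripᵣ⇒sum≤ []      (zero ∷ M)   e = isHStripᵣ⇒sum≤ [] M (∧-trueʳ e)
  isHStripᵣ⇒sum≤ (l ∷ L) (m ∷ M)      e =
    +-mono-≤ (≤ᵇ-true⇒≤ (∧-trueˡ (∧-trueˡ e))) (isHStripᵣ⇒sum≤ L M (∧-trueʳ e))

  isHStripᵣ⇒length≤ : ∀ L M → isHStripᵣ L M ≡ true → Positive M → length M ≤ length L
  isHStripᵣ⇒length≤ L       []      e _        = z≤n
  isHStripᵣ⇒length≤ []      (suc _ ∷ _) () _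
  isHStripᵣ⇒length≤ []      (zero ∷ _) _ (() ∷ _)
  isHStripᵣ⇒length≤ (l ∷ L) (m ∷ M) e (_ ∷ pM) = s≤s (isHStripᵣ⇒length≤ L M (∧-trueʳ e) pM)

  isHStripᵣ⇒bounded : ∀ L M → isHStripᵣ L M ≡ true → All (_≤ part L 0) M
  isHStripᵣ⇒bounded L       []      e = []
  isHStripᵣ⇒bounded []      (m ∷ M) e = ≤ᵇ-true⇒≤ (∧-trueˡ (∧-trueˡ e)) ∷ isHStripᵣ⇒bounded [] M (∧-trueʳ e)
  isHStripᵣ⇒bounded (l ∷ L) (m ∷ M) e =
    m≤l ∷ All.map (λ x≤L₀ → ≤-trans x≤L₀ (≤-trans L₀≤m m≤l)) (isHStripᵣ⇒bounded L M (∧-trueʳ e))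
    where
      m≤l : m ≤ l
      m≤l = ≤ᵇ-true⇒≤ (∧-trueˡ (∧-trueˡ e))
      L₀≤m : part L 0 ≤ m
      L₀≤m = ≤ᵇ-true⇒≤ (∧-trueʳ {m ≤ᵇ l} (∧-trueˡ e))

  firstPart-bounded : ∀ {k mu} → All (_≤ k) mu → firstPart mu ≤ k
  firstPart-bounded []      = z≤n
  firstPart-bounded (m≤ ∷ _) = m≤

  stripCondition : List ℕ → List ℕ → Bool
  stripCondition la mu = isPartition mu ∧ isHStrip la mu

  module _ (la mu : List ℕ) (cond : stripCondition la mu ≡ true) where
    stripCondition⇒isPartition : isPartition mu ≡ true
    stripCondition⇒isPartition = ∧-trueˡ cond

    stripCondition⇒isHStripᵣ : isHStripᵣ la mu ≡ true
    stripCondition⇒isHStripᵣ = trans (sym (isHStrip≡isHStripᵣ la mu)) (∧-trueʳ {isPartition mu} cond)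

    stripCondition⇒firstPart≤ : firstPart mu ≤ firstPart la
    stripCondition⇒firstPart≤ = firstPart-bounded (isHStripᵣ⇒bounded la mu stripCondition⇒isHStripᵣ)

  -- If λ/μ is a horizontal strip then mⱼ(μ) ≤ mⱼ(λ) + 1, so these vectors
  -- contain the multiplicity vectors of all such μ.
  box : ∀ {N} → Vec ℕ N → List (Vec ℕ N)
  box []       = [] ∷ []
  box (u ∷ us) = concatMap (λ v → map (_∷ v) (upTo (suc (suc u)))) (box us)

  InBox : ∀ {N} → Vec ℕ N → Vec ℕ N → Set
  InBox = Pointwise (λ u w → w ≤ suc u)

  isHStripᵣ⇒inBox : ∀ {N} (u w : Vec ℕ N) → isHStripᵣ (fromMult u) (fromMult w) ≡ true → InBox u w
  isHStripᵣ⇒inBox []      []      e = []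
  isHStripᵣ⇒inBox (a ∷ u) (b ∷ w) e = b≤1+a ∷ isHStripᵣ⇒inBox u w strip
    where
      L M : List ℕ
      L = fromMult u
      M = fromMult w
      e′ : (isHStripᵣ L M ∧ columnInterlaces L M a b) ≡ true
      e′ = trans (sym (isHStripᵣ-bump (positive-fromMult u) (positive-fromMult w) a b)) e
      strip : isHStripᵣ L M ≡ true
      strip = ∧-trueˡ {isHStripᵣ L M} e′
      M+b≤L+a : length M + b ≤ length L + a
      M+b≤L+a = ≤ᵇ-true⇒≤ (∧-trueˡ (∧-trueʳ {isHStripᵣ L M} e′))
      L≤1+M : length L ≤ suc (length M)
      L≤1+M with isHStripᵣ⇒length strip (positive-fromMult u) (positive-fromMult w)
      ... | j , j≤1 , eq = ≤-trans (≤-reflexive eq) (≤-trans (+-monoʳ-≤ (length M) j≤1) (≤-reflexive (+-comm (length M) 1)))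
      b≤1+a : b ≤ suc a
      b≤1+a = +-cancelˡ-≤ (length M) b (suc a)
                (≤-trans M+b≤L+a (≤-trans (+-monoˡ-≤ a L≤1+M) (≤-reflexive (sym (+-suc (length M) a)))))

  -- The exponents |λ| − |μ| and r(μ/λ̄) column by column

  indicator : Bool → ℕ
  indicator b = if b then 1 else 0

  rᵣ : List ℕ → List ℕ → ℕ
  rᵣ []      ν = 0
  rᵣ (k ∷ K) ν = indicator (part ν 0 <ᵇ k) + rᵣ K (bar ν)

  countBelow-suc : ∀ k p → countBelow (suc k) p ≡ indicator (p 0) + countBelow k (p ∘ suc)
  countBelow-suc zero    p = +-comm 0 (indicator (p 0))
  countBelow-suc (suc k) p =
    trans (cong (_+ indicator (p (suc k))) (countBelow-suc k p))
          (+-assoc (indicator (p 0)) (countBelow k (p ∘ suc)) (indicator (p (suc k))))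

  countBelow-cong : ∀ k {p q : ℕ → Bool} → (∀ i → p i ≡ q i) → countBelow k p ≡ countBelow k q
  countBelow-cong zero    e = refl
  countBelow-cong (suc k) e = cong₂ _+_ (countBelow-cong k e) (cong indicator (e k))

  r≡rᵣ : ∀ κ ν → r κ ν ≡ rᵣ κ ν
  r≡rᵣ []      ν = refl
  r≡rᵣ (k ∷ K) ν = trans (countBelow-suc (length K) _)
    (cong (indicator (part ν 0 <ᵇ k) +_)
          (trans (countBelow-cong (length K) (λ i → cong (_<ᵇ part K i) (part-bar ν i))) (r≡rᵣ K (bar ν))))

  drop-bar : ∀ n ν → drop n (bar ν) ≡ drop (suc n) ν
  drop-bar n []      = drop-[] n
  drop-bar n (x ∷ ν) = refl

  rᵣ-++ : ∀ κ₁ κ₂ ν → rᵣ (κ₁ ++ κ₂) ν ≡ rᵣ κ₁ ν + rᵣ κ₂ (drop (length κ₁) ν)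
  rᵣ-++ []       κ₂ ν = refl
  rᵣ-++ (k ∷ κ₁) κ₂ ν rewrite rᵣ-++ κ₁ κ₂ (bar ν) | drop-bar (length κ₁) ν =
    sym (+-assoc (indicator (part ν 0 <ᵇ k)) _ _)

  rᵣ-map-suc : ∀ {M} → Positive M → ∀ N c → rᵣ (map suc M) (bump c N) ≡ rᵣ M N
  rᵣ-map-suc []                   N       c       = refl
  rᵣ-map-suc {m ∷ _}     (_ ∷ pM) (n ∷ N) c       = cong (indicator (n <ᵇ m) +_) (rᵣ-map-suc pM N c)
  rᵣ-map-suc {suc _ ∷ _} (_ ∷ pM) []      zero    = cong suc (rᵣ-map-suc pM [] 0)
  rᵣ-map-suc {suc _ ∷ _} (_ ∷ pM) []      (suc c) = cong suc (rᵣ-map-suc pM [] c)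

  rᵣ-ones : ∀ {ν} → Positive ν → ∀ b → rᵣ (ones b) ν ≡ b ∸ length ν
  rᵣ-ones []       zero    = refl
  rᵣ-ones []       (suc b) = cong suc (rᵣ-ones [] b)
  rᵣ-ones (_ ∷ _)  zero    = refl
  rᵣ-ones {suc _ ∷ _} (_ ∷ pν) (suc b) = rᵣ-ones pν b

  r-bump : ∀ {L M} → Positive L → Positive M → ∀ a b →
           r (bump b M) (bar (bump a L)) ≡ r M (bar L) + (b ∸ ((length L + a ∸ 1) ∸ length M))
  r-bump {L} {M} pL pM a b with bar-bump L a
  ... | c , e = begin
      r (bump b M) (bar (bump a L))
    ≡⟨ r≡rᵣ (bump b M) _ ⟩
      rᵣ (bump b M) (bar (bump a L))
    ≡⟨ rᵣ-++ (map suc M) (ones b) _ ⟩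
      rᵣ (map suc M) (bar (bump a L)) + rᵣ (ones b) (drop (length (map suc M)) (bar (bump a L)))
    ≡⟨ cong₂ _+_ (trans (cong (rᵣ (map suc M)) e) (rᵣ-map-suc pM (bar L) c))
                 (rᵣ-ones (drop⁺ (length (map suc M)) (drop⁺ 1 (positive-bump a L))) b) ⟩
      rᵣ M (bar L) + (b ∸ length (drop (length (map suc M)) (bar (bump a L))))
    ≡⟨ cong (λ z → rᵣ M (bar L) + (b ∸ z))
         (trans (length-drop (length (map suc M)) (bar (bump a L)))
                (cong₂ _∸_ (trans (length-drop 1 (bump a L)) (cong (_∸ 1) (length-bump L a))) (length-map suc M))) ⟩
      rᵣ M (bar L) + (b ∸ ((length L + a ∸ 1) ∸ length M))
    ≡⟨ cong (_+ (b ∸ ((length L + a ∸ 1) ∸ length M))) (sym (r≡rᵣ M (bar L))) ⟩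
      r M (bar L) + (b ∸ ((length L + a ∸ 1) ∸ length M))
    ∎ where open ≡-Reasoning

  sum-map-suc : ∀ L → sum (map suc L) ≡ sum L + length L
  sum-map-suc []      = refl
  sum-map-suc (l ∷ L) rewrite sum-map-suc L = lemma l (sum L) (length L)
    where
      lemma : ∀ x y z → suc x + (y + z) ≡ x + y + suc z
      lemma = solve-∀

  sum-ones : ∀ a → sum (ones a) ≡ a
  sum-ones zero    = refl
  sum-ones (suc a) = cong suc (sum-ones a)

  sum-bump : ∀ L a → sum (bump a L) ≡ sum L + length L + a
  sum-bump L a rewrite sum-++ (map suc L) (ones a) | sum-map-suc L | sum-ones a = refl

  -- ℓ(bump a L) = ℓ(bump b M) + k.
  ColumnBalance : List ℕ → List ℕ → ℕ → ℕ → ℕ → Set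
  ColumnBalance L M a b k = length L + a ≡ length M + b + k

  sum-bump-∸ : ∀ {L M} a b k → sum M ≤ sum L → ColumnBalance L M a b k →
               sum (bump a L) ∸ sum (bump b M) ≡ (sum L ∸ sum M) + k
  sum-bump-∸ {L} {M} a b k M≤L balance = begin
      sum (bump a L) ∸ sum (bump b M)
    ≡⟨ cong₂ _∸_ (sum-bump L a) (sum-bump M b) ⟩
      (sum L + length L + a) ∸ (sum M + length M + b)
    ≡⟨ cong (_∸ (sum M + length M + b))
            (trans (+-assoc (sum L) (length L) a) (cong₂ _+_ (sym (m∸n+n≡m M≤L)) balance)) ⟩
      ((sum L ∸ sum M) + sum M + (length M + b + k)) ∸ (sum M + length M + b)
    ≡⟨ cong (_∸ (sum M + length M + b)) (regroup (sum L ∸ sum M) (sum M) (length M) b k) ⟩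
      ((sum L ∸ sum M) + k) + (sum M + length M + b) ∸ (sum M + length M + b)
    ≡⟨ m+n∸n≡m ((sum L ∸ sum M) + k) (sum M + length M + b) ⟩
      (sum L ∸ sum M) + k
    ∎ where
      open ≡-Reasoning
      regroup : ∀ d s m b k → (d + s) + (m + b + k) ≡ (d + k) + (s + m + b)
      regroup = solve-∀

  +≡ᵇ+ : ∀ n x y → (n + x ≡ᵇ n + y) ≡ (x ≡ᵇ y)
  +≡ᵇ+ zero    x y = refl
  +≡ᵇ+ (suc n) x y = +≡ᵇ+ n x y

  balance≡ᵇ : ∀ {L M : List ℕ} j a b k → length L ≡ length M + j →
              (length L + a ≡ᵇ length M + b + k) ≡ (j + a ≡ᵇ k + b)
  balance≡ᵇ {L} {M} j a b k el
    rewrite el | +-assoc (length M) j a | +-assoc (length M) b k | +-comm b k = +≡ᵇ+ (length M) (j + a) (k + b)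

  balance⇒columnInterlaces : ∀ {L M} a b k → k ≤ 1 → ColumnBalance L M a b k → columnInterlaces L M a b ≡ true
  balance⇒columnInterlaces {L} {M} a b k k≤1 balance rewrite balance =
    cong₂ _∧_ (≤⇒≤ᵇ-true (m≤m+n (length M + b) k))
              (≤⇒≤ᵇ-true (≤-trans (+-monoʳ-≤ (length M + b) k≤1) (≤-reflexive (+-comm (length M + b) 1))))

  -- The parts of μ equal to 1 add one to r(μ/λ̄) exactly when there are
  -- some and the horizontal label entering the first column is 0.
  bExponent : ℕ → ℕ → ℕ
  bExponent k b = indicator ((k ≡ᵇ 0) ∧ (0 <ᵇ b))

  suc-n∸n≡1 : ∀ m → suc m ∸ m ≡ 1
  suc-n∸n≡1 zero    = refl
  suc-n∸n≡1 (suc m) = suc-n∸n≡1 m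

  column-excess : ∀ lL lM a b k → k ≤ 1 → lL + a ≡ lM + b + k →
                  b ∸ ((lL + a ∸ 1) ∸ lM) ≡ bExponent k b
  column-excess lL lM a zero    zero       _ e rewrite e | +-identityʳ lM | +-identityʳ lM = 0∸n≡0 ((lM ∸ 1) ∸ lM)
  column-excess lL lM a (suc b) zero       _ e
    rewrite e | +-identityʳ (lM + suc b) | +-suc lM b | m+n∸m≡n lM b = suc-n∸n≡1 b
  column-excess lL lM a b       (suc zero) _ e
    rewrite e | +-suc (lM + b) 0 | +-identityʳ (lM + b) | m+n∸m≡n lM b = n∸n≡0 b
  column-excess lL lM a b       (suc (suc k)) (s≤s ()) e

  r-bump-balanced : ∀ {L M} → Positive L → Positive M → ∀ a b k → k ≤ 1 → ColumnBalance L M a b k →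
                    r (bump b M) (bar (bump a L)) ≡ r M (bar L) + bExponent k b
  r-bump-balanced {L} {M} pL pM a b k k≤1 balance =
    trans (r-bump pL pM a b) (cong (r M (bar L) +_) (column-excess (length L) (length M) a b k k≤1 balance))

  tabulate-∷ʳ : ∀ {a} {A : Set a} {n} (f : Fin (suc n) → A) → tabulate f ≡ tabulate (f ∘ inject₁) ∷ʳ f (fromℕ n)
  tabulate-∷ʳ {n = zero}  f = refl
  tabulate-∷ʳ {n = suc n} f = cong (f Fin.zero ∷_) (tabulate-∷ʳ (f ∘ Fin.suc))
    where import Data.Fin as Fin

  map-allFin-suc : ∀ {a} {A : Set a} n (g : Fin (suc n) → A) →
                   map g (allFin (suc n)) ≡ map (g ∘ inject₁) (allFin n) ∷ʳ g (fromℕ n)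
  map-allFin-suc n g =
    trans (map-tabulate id g) (trans (tabulate-∷ʳ g) (cong (_∷ʳ g (fromℕ n)) (sym (map-tabulate id (g ∘ inject₁)))))

  map-reverse-allFin-suc : ∀ {a} {A : Set a} n (g : Fin (suc n) → A) →
                           map g (reverse (allFin (suc n))) ≡ g (fromℕ n) ∷ map (g ∘ inject₁) (reverse (allFin n))
  map-reverse-allFin-suc n g = begin
      map g (reverse (allFin (suc n)))
    ≡⟨ reverse-map g (allFin (suc n)) ⟩
      reverse (map g (allFin (suc n)))
    ≡⟨ cong reverse (map-allFin-suc n g) ⟩
      reverse (map (g ∘ inject₁) (allFin n) ∷ʳ g (fromℕ n))
    ≡⟨ reverse-++ (map (g ∘ inject₁) (allFin n)) (g (fromℕ n) ∷ []) ⟩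
      g (fromℕ n) ∷ reverse (map (g ∘ inject₁) (allFin n))
    ≡⟨ cong (g (fromℕ n) ∷_) (sym (reverse-map (g ∘ inject₁) (allFin n))) ⟩
      g (fromℕ n) ∷ map (g ∘ inject₁) (reverse (allFin n))
    ∎ where open ≡-Reasoning

module PartitionFunctions {c ℓ} (R : CommutativeRing c ℓ) where
  import Algebra.Properties.CommutativeSemigroup as CommutativeSemigroupProperties
  open import Data.Nat as ℕ using (ℕ; zero; suc; _∸_; _≡ᵇ_; _≤_; _<_; z≤n; s≤s)
  open import Data.Nat.ListAction using (sum)
  import Data.Nat.Properties as ℕ
  open import Data.Bool using (Bool; true; false; _∧_; if_then_else_)
  open import Data.Bool.Properties using (∧-zeroʳ)
  open import Data.List using (List; []; _∷_; map; length; _++_; _∷ʳ_; concatMap; filter; upTo; allFin; reverse)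
  import Data.List.Properties as List
  open import Data.List.Relation.Unary.All using (All; []; _∷_)
  open import Data.Vec using (Vec; []; _∷_; replicate)
  open import Data.Fin using (Fin; inject₁; fromℕ)
  open import Function using (_∘_)
  open import Data.Vec.Relation.Binary.Pointwise.Inductive using ([]; _∷_)
  open import Data.Product using (_,_; proj₁; proj₂)
  open import Data.Sum using (inj₁; inj₂)
  open import Relation.Nullary.Decidable.Core using (T?)
  import Relation.Binary.PropositionalEquality as P
  open P using (_≡_)
  open Partitions
  open CommutativeRing R
  open import Relation.Binary.Reasoning.Setoid setoid
  module +-CS = CommutativeSemigroupProperties +-commutativeSemigroup
  module *-CS = CommutativeSemigroupProperties *-commutativeSemigroup

  _when_ : Carrier → Bool → Carrier
  x when b = if b then x else 0#

  when-true : ∀ {b} x → b ≡ true → x when b ≈ x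
  when-true x P.refl = refl

  when-false : ∀ {b} x → b ≡ false → x when b ≈ 0#
  when-false x P.refl = refl

  when-cong : ∀ {x y} b → x ≈ y → x when b ≈ y when b
  when-cong true  x≈y = x≈y
  when-cong false _   = refl

  0#-when : ∀ b → 0# when b ≈ 0#
  0#-when true  = refl
  0#-when false = refl

  when-cong⇒ : ∀ {x y} p q → p ≡ q → (p ≡ true → x ≈ y) → x when p ≈ y when q
  when-cong⇒ true  _ P.refl x≈y = x≈y P.refl
  when-cong⇒ false _ P.refl _   = refl

  when-∧ : ∀ p q x → x when (p ∧ q) ≈ (x when q) when p
  when-∧ true  q x = refl
  when-∧ false q x = refl

  *-when : ∀ x y b → x * (y when b) ≈ (x * y) when b
  *-when x y true  = refl
  *-when x y false = zeroʳ x

  ∑ : ∀ {a} {X : Set a} → (X → Carrier) → List X → Carrier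
  ∑ f L = sumR R (map f L)

  module _ {a} {X : Set a} where
    ∑-cong : ∀ {f g : X → Carrier} L → (∀ x → f x ≈ g x) → ∑ f L ≈ ∑ g L
    ∑-cong []      e = refl
    ∑-cong (x ∷ L) e = +-cong (e x) (∑-cong L e)

    ∑-++ : ∀ (f : X → Carrier) xs ys → ∑ f (xs ++ ys) ≈ ∑ f xs + ∑ f ys
    ∑-++ f []       ys = sym (+-identityˡ _)
    ∑-++ f (x ∷ xs) ys = trans (+-cong refl (∑-++ f xs ys)) (sym (+-assoc _ _ _))

    ∑-+ : ∀ (f g : X → Carrier) L → ∑ (λ x → f x + g x) L ≈ ∑ f L + ∑ g L
    ∑-+ f g []      = sym (+-identityˡ _)
    ∑-+ f g (x ∷ L) = trans (+-cong refl (∑-+ f g L)) (+-CS.interchange (f x) (g x) (∑ f L) (∑ g L))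

    ∑-*ˡ : ∀ k (f : X → Carrier) L → k * ∑ f L ≈ ∑ (λ x → k * f x) L
    ∑-*ˡ k f []      = zeroʳ k
    ∑-*ˡ k f (x ∷ L) = trans (distribˡ k _ _) (+-cong refl (∑-*ˡ k f L))

    ∑-*ʳ : ∀ k (f : X → Carrier) L → ∑ f L * k ≈ ∑ (λ x → f x * k) L
    ∑-*ʳ k f L = trans (*-comm _ k) (trans (∑-*ˡ k f L) (∑-cong L (λ x → *-comm k (f x))))

    ∑-zero : ∀ {f : X → Carrier} L → (∀ x → f x ≈ 0#) → ∑ f L ≈ 0#
    ∑-zero []      e = refl
    ∑-zero (x ∷ L) e = trans (+-cong (e x) (∑-zero L e)) (+-identityˡ 0#)

    ∑-filter : ∀ (q : X → Bool) (f : X → Carrier) L →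
               ∑ f (filter (λ x → T? (q x)) L) ≈ ∑ (λ x → f x when q x) L
    ∑-filter q f []      = refl
    ∑-filter q f (x ∷ L) with q x
    ... | true  = +-cong refl (∑-filter q f L)
    ... | false = trans (∑-filter q f L) (sym (+-identityˡ _))

  module _ {a b} {X : Set a} {Y : Set b} where
    ∑-concatMap : ∀ (f : Y → Carrier) (g : X → List Y) L → ∑ f (concatMap g L) ≈ ∑ (λ x → ∑ f (g x)) L
    ∑-concatMap f g []      = refl
    ∑-concatMap f g (x ∷ L) = trans (∑-++ f (g x) (concatMap g L)) (+-cong refl (∑-concatMap f g L))

    ∑-swap : ∀ (f : X → Y → Carrier) L₁ L₂ → ∑ (λ x → ∑ (f x) L₂) L₁ ≈ ∑ (λ y → ∑ (λ x → f x y) L₁) L₂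
    ∑-swap f []       L₂ = sym (∑-zero L₂ (λ _ → refl))
    ∑-swap f (x ∷ L₁) L₂ = trans (+-cong refl (∑-swap f L₁ L₂)) (sym (∑-+ (f x) (λ y → ∑ (λ x → f x y) L₁) L₂))

    ∑-map : ∀ (f : Y → Carrier) (g : X → Y) L → ∑ f (map g L) ≈ ∑ (λ x → f (g x)) L
    ∑-map f g L = reflexive (P.cong (sumR R) (P.sym (List.map-∘ L)))

  ∑-upTo-suc : ∀ (f : ℕ → Carrier) n → ∑ f (upTo (suc n)) ≈ ∑ f (upTo n) + f n
  ∑-upTo-suc f n = trans (reflexive (P.cong (∑ f) (P.sym (List.upTo-∷ʳ n))))
                         (trans (∑-++ f (upTo n) (n ∷ [])) (+-cong refl (+-identityʳ _)))

  ∑-upTo-out : ∀ n j x → n ≤ j → ∑ (λ i → x when (j ≡ᵇ i)) (upTo n) ≈ 0#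
  ∑-upTo-out zero    j x le = refl
  ∑-upTo-out (suc n) j x le =
    trans (∑-upTo-suc (λ i → x when (j ≡ᵇ i)) n)
      (trans (+-cong (∑-upTo-out n j x (ℕ.≤-trans (ℕ.n≤1+n n) le))
                     (when-false x (≢⇒≡ᵇ-false j n (λ e → ℕ.<⇒≢ le (P.sym e)))))
             (+-identityˡ _))

  ∑-upTo-δ : ∀ n j x → j < n → ∑ (λ i → x when (j ≡ᵇ i)) (upTo n) ≈ x
  ∑-upTo-δ (suc n) j x j<1+n with ℕ.m≤n⇒m<n∨m≡n (ℕ.≤-pred j<1+n)
  ... | inj₁ j<n =
    trans (∑-upTo-suc (λ i → x when (j ≡ᵇ i)) n)
      (trans (+-cong (∑-upTo-δ n j x j<n) (when-false x (≢⇒≡ᵇ-false j n (ℕ.<⇒≢ j<n)))) (+-identityʳ _))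
  ... | inj₂ P.refl =
    trans (∑-upTo-suc (λ i → x when (j ≡ᵇ i)) n)
      (trans (+-cong (∑-upTo-out n n x ℕ.≤-refl) (when-true x (≡ᵇ-refl n))) (+-identityˡ _))

  ∑-box : ∀ {N} (f : Vec ℕ (suc N) → Carrier) u (us : Vec ℕ N) →
          ∑ f (box (u ∷ us)) ≈ ∑ (λ v → ∑ (λ a → f (a ∷ v)) (upTo (suc (suc u)))) (box us)
  ∑-box f u us = trans (∑-concatMap f _ (box us)) (∑-cong (box us) (λ v → ∑-map f (_∷ v) (upTo (suc (suc u)))))

  ∑-box-δ : ∀ {N} (u w : Vec ℕ N) x → InBox u w → ∑ (λ v → x when vecEq w v) (box u) ≈ x
  ∑-box-δ []       []       x []            = +-identityʳ x
  ∑-box-δ (u ∷ us) (w ∷ ws) x (w≤1+u ∷ inB) = begin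
      ∑ (λ v → x when vecEq (w ∷ ws) v) (box (u ∷ us))
    ≈⟨ ∑-box _ u us ⟩
      ∑ (λ v → ∑ (λ a → x when ((w ≡ᵇ a) ∧ vecEq ws v)) (upTo (suc (suc u)))) (box us)
    ≈⟨ ∑-cong (box us) (λ v → ∑-cong (upTo (suc (suc u))) (λ a → when-∧ (w ≡ᵇ a) (vecEq ws v) x)) ⟩
      ∑ (λ v → ∑ (λ a → (x when vecEq ws v) when (w ≡ᵇ a)) (upTo (suc (suc u)))) (box us)
    ≈⟨ ∑-cong (box us) (λ v → ∑-upTo-δ (suc (suc u)) w _ (s≤s w≤1+u)) ⟩
      ∑ (λ v → x when vecEq ws v) (box us)
    ≈⟨ ∑-box-δ us ws x inB ⟩
      x
    ∎

  ∑-listsOfLen-δ : ∀ M k x y → All (_≤ M) x →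
                   ∑ (λ μ → y when listEq x μ) (listsOfLen M k) ≈ y when (length x ≡ᵇ k)
  ∑-listsOfLen-δ M zero    []      y _ = +-identityʳ y
  ∑-listsOfLen-δ M zero    (a ∷ x) y _ = +-identityʳ 0#
  ∑-listsOfLen-δ M (suc k) []      y _ =
    trans (∑-concatMap _ _ (listsOfLen M k))
          (∑-zero (listsOfLen M k) (λ l → trans (∑-map _ _ (upTo (suc M))) (∑-zero (upTo (suc M)) (λ _ → refl))))
  ∑-listsOfLen-δ M (suc k) (a ∷ x) y (a≤M ∷ x≤M) = begin
      ∑ (λ μ → y when listEq (a ∷ x) μ) (listsOfLen M (suc k))
    ≈⟨ ∑-concatMap _ _ (listsOfLen M k) ⟩
      ∑ (λ l → ∑ (λ μ → y when listEq (a ∷ x) μ) (map (_∷ l) (upTo (suc M)))) (listsOfLen M k)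
    ≈⟨ ∑-cong (listsOfLen M k) (λ l → trans (∑-map _ _ (upTo (suc M)))
         (trans (∑-cong (upTo (suc M)) (λ b → when-∧ (a ≡ᵇ b) (listEq x l) y)) (∑-upTo-δ (suc M) a _ (s≤s a≤M)))) ⟩
      ∑ (λ l → y when listEq x l) (listsOfLen M k)
    ≈⟨ ∑-listsOfLen-δ M k x y x≤M ⟩
      y when (length x ≡ᵇ k)
    ∎

  ∑-listsUpTo-δ : ∀ M K x y → All (_≤ M) x → length x ≤ K →
                  ∑ (λ μ → y when listEq x μ) (listsUpTo M K) ≈ y
  ∑-listsUpTo-δ M K x y x≤M len≤K =
    trans (∑-concatMap _ (listsOfLen M) (upTo (suc K)))
          (trans (∑-cong (upTo (suc K)) (λ k → ∑-listsOfLen-δ M k x y x≤M))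
                 (∑-upTo-δ (suc K) (length x) y (s≤s len≤K)))

  1#-when-∧ : ∀ p q → 1# when (p ∧ q) ≈ (1# when p) * (1# when q)
  1#-when-∧ true  q = sym (*-identityˡ _)
  1#-when-∧ false q = sym (zeroˡ _)

  *-1#-when : ∀ x b → x * (1# when b) ≈ x when b
  *-1#-when x b = trans (*-when x 1# b) (when-cong b (*-identityʳ x))

  ∑-upTo-collapse : ∀ n d W (X : ℕ → Carrier) → d < n → ∑ (λ b → (W when (b ≡ᵇ d)) * X b) (upTo n) ≈ W * X d
  ∑-upTo-collapse n d W X d<n = trans (∑-cong (upTo n) pointwise) (∑-upTo-δ n d (W * X d) d<n)
    where
      pointwise : ∀ b → (W when (b ≡ᵇ d)) * X b ≈ (W * X d) when (d ≡ᵇ b)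
      pointwise b with b ≡ᵇ d in e
      ... | true  rewrite ≡ᵇ-true⇒≡ b d e | ≡ᵇ-refl d = refl
      ... | false rewrite ≡ᵇ-sym d b | e = zeroˡ _

  -- The one-row transfer matrix

  pow-+ : ∀ x m n → pow R x (m ℕ.+ n) ≈ pow R x m * pow R x n
  pow-+ x zero    n = sym (*-identityˡ _)
  pow-+ x (suc m) n = trans (*-cong refl (pow-+ x m n)) (sym (*-assoc _ _ _))

  module Transfer (A B : Carrier) where

    branchWeight : List ℕ → List ℕ → Carrier
    branchWeight mu la = pow R A (sum la ∸ sum mu) * pow R B (r mu (bar la))

    -- The weight of a vertex with left label k ∈ {0,1} and bottom label b; it
    -- is the common value of wZ and, with complemented horizontal labels and
    -- top and bottom exchanged, of wZ*.
    vertexWeight : ℕ → ℕ → Carrier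
    vertexWeight k b = pow R A k * pow R B (bExponent k b)

    -- A column with top label u, bottom label v, left label k and right
    -- label k′ (conservation k + v = k′ + u).
    colWeight : ℕ → ℕ → ℕ → ℕ → Carrier
    colWeight k u v k′ = vertexWeight k v when (k′ ℕ.+ u ≡ᵇ k ℕ.+ v)

    -- One row with bottom multiplicities v and top multiplicities u, left
    -- label k at the first column and right boundary 0.
    transfer : ℕ → ∀ {N} → Vec ℕ N → Vec ℕ N → Carrier
    transfer k []       []       = 1# when (k ≡ᵇ 0)
    transfer k (u ∷ us) (v ∷ vs) = colWeight k u v 0 * transfer 0 us vs + colWeight k u v 1 * transfer 1 us vs

    branch : ℕ → ∀ {N} → Vec ℕ N → Vec ℕ N → Carrier
    branch k u v = branchWeight (fromMult v) (fromMult u)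
                   when (isHStripᵣ (fromMult u) (fromMult v) ∧ (length (fromMult u) ≡ᵇ length (fromMult v) ℕ.+ k))

    branchWeight-bump : ∀ {L M} → Positive L → Positive M → isHStripᵣ L M ≡ true →
                        ∀ a b k → k ≤ 1 → ColumnBalance L M a b k →
                        branchWeight (bump b M) (bump a L) ≈ vertexWeight k b * branchWeight M L
    branchWeight-bump {L} {M} pL pM strip a b k k≤1 balance = begin
        branchWeight (bump b M) (bump a L)
      ≡⟨ P.cong₂ (λ m n → pow R A m * pow R B n)
                 (sum-bump-∸ {L} {M} a b k (isHStripᵣ⇒sum≤ L M strip) balance)
                 (r-bump-balanced pL pM a b k k≤1 balance) ⟩
        pow R A ((sum L ∸ sum M) ℕ.+ k) * pow R B (r M (bar L) ℕ.+ bExponent k b)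
      ≈⟨ *-cong (pow-+ A (sum L ∸ sum M) k) (pow-+ B (r M (bar L)) (bExponent k b)) ⟩
        (pow R A (sum L ∸ sum M) * pow R A k) * (pow R B (r M (bar L)) * pow R B (bExponent k b))
      ≈⟨ *-CS.interchange _ _ _ _ ⟩
        branchWeight M L * vertexWeight k b
      ≈⟨ *-comm _ _ ⟩
        vertexWeight k b * branchWeight M L
      ∎

    module _ {N} (u v : Vec ℕ N) where
      private
        L M : List ℕ
        L = fromMult u
        M = fromMult v

      branch-bump : ∀ a b k → branch k (a ∷ u) (b ∷ v) ≡
        branchWeight (bump b M) (bump a L)
          when ((isHStripᵣ L M ∧ columnInterlaces L M a b) ∧ (length L ℕ.+ a ≡ᵇ length M ℕ.+ b ℕ.+ k))
      branch-bump a b k = P.cong₂ (λ s l → branchWeight (bump b M) (bump a L) when (s ∧ l))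
        (isHStripᵣ-bump (positive-fromMult u) (positive-fromMult v) a b)
        (P.cong₂ _≡ᵇ_ (length-bump L a) (P.cong (ℕ._+ k) (length-bump M b)))

      branch-select : ∀ j k → isHStripᵣ L M ≡ true → length L ≡ length M ℕ.+ j →
                      branch k u v ≈ branchWeight M L when (j ≡ᵇ k)
      branch-select j k strip el = reflexive (P.cong (branchWeight M L when_)
        (P.cong₂ _∧_ strip (P.trans (P.cong (_≡ᵇ length M ℕ.+ k) el) (+≡ᵇ+ (length M) j k))))

      branch-nonstrip : ∀ k → isHStripᵣ L M ≡ false → branch k u v ≈ 0#
      branch-nonstrip k notStrip = when-false _ (P.cong (_∧ (length L ≡ᵇ length M ℕ.+ k)) notStrip)

      branch-bump-nonstrip : ∀ a b k → isHStripᵣ L M ≡ false → branch k (a ∷ u) (b ∷ v) ≈ 0#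
      branch-bump-nonstrip a b k notStrip =
        trans (reflexive (branch-bump a b k)) (when-false _
          (P.cong (λ s → (s ∧ columnInterlaces L M a b) ∧ (length L ℕ.+ a ≡ᵇ length M ℕ.+ b ℕ.+ k)) notStrip))

      branch-bump-strip : ∀ j a b k → k ≤ 1 → isHStripᵣ L M ≡ true → length L ≡ length M ℕ.+ j →
                          colWeight k a b j * branchWeight M L ≈ branch k (a ∷ u) (b ∷ v)
      branch-bump-strip j a b k k≤1 strip el with j ℕ.+ a ≡ᵇ k ℕ.+ b in ej
      ... | false = trans (zeroˡ _) (sym (trans (reflexive (branch-bump a b k))
                      (when-false _ (P.trans (P.cong (strip∧interlace ∧_) (P.trans (balance≡ᵇ {L} {M} j a b k el) ej))
                                          (∧-zeroʳ strip∧interlace)))))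
        where strip∧interlace = isHStripᵣ L M ∧ columnInterlaces L M a b
      ... | true = sym (begin
          branch k (a ∷ u) (b ∷ v)
        ≡⟨ branch-bump a b k ⟩
          branchWeight (bump b M) (bump a L) when ((isHStripᵣ L M ∧ columnInterlaces L M a b) ∧ (length L ℕ.+ a ≡ᵇ length M ℕ.+ b ℕ.+ k))
        ≈⟨ when-true _ (P.cong₂ _∧_ (P.cong₂ _∧_ strip (balance⇒columnInterlaces {L} {M} a b k k≤1 balance)) lenTrue) ⟩
          branchWeight (bump b M) (bump a L)
        ≈⟨ branchWeight-bump (positive-fromMult u) (positive-fromMult v) strip a b k k≤1 balance ⟩
          vertexWeight k b * branchWeight M L
        ∎)
        where
          lenTrue : (length L ℕ.+ a ≡ᵇ length M ℕ.+ b ℕ.+ k) ≡ true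
          lenTrue = P.trans (balance≡ᵇ {L} {M} j a b k el) ej
          balance : ColumnBalance L M a b k
          balance = ≡ᵇ-true⇒≡ _ _ lenTrue

    select₀₁ : ∀ (f : ℕ → Carrier) W j → j ≤ 1 → f 0 * (W when (j ≡ᵇ 0)) + f 1 * (W when (j ≡ᵇ 1)) ≈ f j * W
    select₀₁ f W zero       _ = trans (+-cong refl (zeroʳ _)) (+-identityʳ _)
    select₀₁ f W (suc zero) _ = trans (+-cong (zeroʳ _) refl) (+-identityˡ _)
    select₀₁ f W (suc (suc j)) (s≤s ())

    when₀₁ : ∀ W j → j ≤ 1 → W when (j ≡ᵇ 0) + W when (j ≡ᵇ 1) ≈ W
    when₀₁ W zero       _ = +-identityʳ W
    when₀₁ W (suc zero) _ = +-identityˡ W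
    when₀₁ W (suc (suc j)) (s≤s ())

    transfer≈branch : ∀ k → k ≤ 1 → ∀ {N} (u v : Vec ℕ N) → transfer k u v ≈ branch k u v
    transfer≈branch zero       _ []      []      = sym (*-identityˡ 1#)
    transfer≈branch (suc zero) _ []      []      = refl
    transfer≈branch (suc (suc k)) (s≤s ()) [] []
    transfer≈branch k          k≤1 (a ∷ u) (b ∷ v) =
      trans (+-cong (*-cong refl (transfer≈branch 0 z≤n u v)) (*-cong refl (transfer≈branch 1 (s≤s z≤n) u v)))
            (column (isHStripᵣ L M) P.refl)
      where
        L M : List ℕ
        L = fromMult u
        M = fromMult v
        column : ∀ s → isHStripᵣ L M ≡ s →
                 colWeight k a b 0 * branch 0 u v + colWeight k a b 1 * branch 1 u v ≈ branch k (a ∷ u) (b ∷ v)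
        column false notStrip = begin
            colWeight k a b 0 * branch 0 u v + colWeight k a b 1 * branch 1 u v
          ≈⟨ +-cong (*-cong refl (branch-nonstrip u v 0 notStrip)) (*-cong refl (branch-nonstrip u v 1 notStrip)) ⟩
            colWeight k a b 0 * 0# + colWeight k a b 1 * 0#
          ≈⟨ trans (+-cong (zeroʳ _) (zeroʳ _)) (+-identityʳ 0#) ⟩
            0#
          ≈⟨ branch-bump-nonstrip u v a b k notStrip ⟨
            branch k (a ∷ u) (b ∷ v)
          ∎
        column true strip with isHStripᵣ⇒length strip (positive-fromMult u) (positive-fromMult v)
        ... | j , j≤1 , el = begin
            colWeight k a b 0 * branch 0 u v + colWeight k a b 1 * branch 1 u v
          ≈⟨ +-cong (*-cong refl (branch-select u v j 0 strip el)) (*-cong refl (branch-select u v j 1 strip el)) ⟩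
            colWeight k a b 0 * (branchWeight M L when (j ≡ᵇ 0)) + colWeight k a b 1 * (branchWeight M L when (j ≡ᵇ 1))
          ≈⟨ select₀₁ (colWeight k a b) (branchWeight M L) j j≤1 ⟩
            colWeight k a b j * branchWeight M L
          ≈⟨ branch-bump-strip u v j a b k k≤1 strip el ⟩
            branch k (a ∷ u) (b ∷ v)
          ∎

    transfer₀₁ : ∀ {N} → Vec ℕ N → Vec ℕ N → Carrier
    transfer₀₁ u v = transfer 0 u v + transfer 1 u v

    transfer₀₁≈branchWeight : ∀ {N} (u v : Vec ℕ N) →
      transfer₀₁ u v ≈ branchWeight (fromMult v) (fromMult u) when isHStripᵣ (fromMult u) (fromMult v)
    transfer₀₁≈branchWeight u v =
      trans (+-cong (transfer≈branch 0 z≤n u v) (transfer≈branch 1 (s≤s z≤n) u v)) (bothLabels (isHStripᵣ L M) P.refl)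
      where
        L M : List ℕ
        L = fromMult u
        M = fromMult v
        bothLabels : ∀ s → isHStripᵣ L M ≡ s → branch 0 u v + branch 1 u v ≈ branchWeight M L when s
        bothLabels false notStrip =
          trans (+-cong (branch-nonstrip u v 0 notStrip) (branch-nonstrip u v 1 notStrip)) (+-identityʳ 0#)
        bothLabels true strip with isHStripᵣ⇒length strip (positive-fromMult u) (positive-fromMult v)
        ... | j , j≤1 , el =
          trans (+-cong (branch-select u v j 0 strip el) (branch-select u v j 1 strip el)) (when₀₁ _ j j≤1)

    module _ {N} (la : List ℕ) (isP : isPartition la ≡ true) (la≤N : firstPart la ≤ N) where
      private
        u : Vec ℕ N
        u = mult la N
        candidates : List (List ℕ)
        candidates = listsUpTo (firstPart la) (length la)

      fromMult-mult-la : fromMult u ≡ la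
      fromMult-mult-la = fromMult-mult N la isP la≤N

      fromMult-mult-strip : ∀ mu → stripCondition la mu ≡ true → fromMult (mult mu N) ≡ mu
      fromMult-mult-strip mu c =
        fromMult-mult N mu (stripCondition⇒isPartition la mu c) (ℕ.≤-trans (stripCondition⇒firstPart≤ la mu c) la≤N)

      ∑-strips-cong : ∀ {f g : List ℕ → Carrier} → (∀ mu → stripCondition la mu ≡ true → f mu ≈ g mu) →
                      ∑ f (strips la) ≈ ∑ g (strips la)
      ∑-strips-cong {f} {g} f≈g = begin
          ∑ f (strips la)
        ≈⟨ ∑-filter (stripCondition la) f candidates ⟩
          ∑ (λ mu → f mu when stripCondition la mu) candidates
        ≈⟨ ∑-cong candidates pointwise ⟩
          ∑ (λ mu → g mu when stripCondition la mu) candidates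
        ≈⟨ ∑-filter (stripCondition la) g candidates ⟨
          ∑ g (strips la)
        ∎
        where
          pointwise : ∀ mu → f mu when stripCondition la mu ≈ g mu when stripCondition la mu
          pointwise mu with stripCondition la mu in c
          ... | true  = f≈g mu c
          ... | false = refl

      listEq-fromMult : ∀ v mu → stripCondition la mu ≡ true → vecEq v (mult mu N) ≡ true → listEq (fromMult v) mu ≡ true
      listEq-fromMult v mu c ev rewrite vecEq-true⇒≡ v (mult mu N) ev | fromMult-mult-strip mu c = listEq-refl mu

      stripIndicator : Vec ℕ N → List ℕ → Carrier
      stripIndicator v mu = (branchWeight mu la * (1# when vecEq v (mult mu N))) when stripCondition la mu

      stripIndicator-fromMult : ∀ v → stripIndicator v (fromMult v) ≈ branchWeight (fromMult v) la when isHStripᵣ la (fromMult v)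
      stripIndicator-fromMult v
        rewrite isPartition-fromMult v | isHStrip≡isHStripᵣ la (fromMult v) | mult-fromMult v | vecEq-refl v
        = when-cong (isHStripᵣ la (fromMult v)) (*-identityʳ _)

      stripIndicator-δ : ∀ v mu → stripIndicator v mu ≈
        (branchWeight (fromMult v) la when isHStripᵣ la (fromMult v)) when listEq (fromMult v) mu
      stripIndicator-δ v mu with listEq (fromMult v) mu in eq
      ... | true rewrite P.sym (listEq-true⇒≡ (fromMult v) mu eq) = stripIndicator-fromMult v
      ... | false with stripCondition la mu in c
      ...   | false = refl
      ...   | true with vecEq v (mult mu N) in ev
      ...     | false = zeroʳ _
      ...     | true with () ← P.trans (P.sym eq) (listEq-fromMult v mu c ev)

      ∑-strips-δ : ∀ v → ∑ (λ mu → branchWeight mu la * (1# when vecEq v (mult mu N))) (strips la) ≈ transfer₀₁ u v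
      ∑-strips-δ v = begin
          ∑ (λ mu → branchWeight mu la * (1# when vecEq v (mult mu N))) (strips la)
        ≈⟨ ∑-filter (stripCondition la) _ candidates ⟩
          ∑ (stripIndicator v) candidates
        ≈⟨ ∑-cong candidates (stripIndicator-δ v) ⟩
          ∑ (λ mu → Y when listEq (fromMult v) mu) candidates
        ≈⟨ collapse (isHStripᵣ la (fromMult v)) P.refl ⟩
          Y
        ≡⟨ P.cong (λ l → branchWeight (fromMult v) l when isHStripᵣ l (fromMult v)) (P.sym fromMult-mult-la) ⟩
          branchWeight (fromMult v) (fromMult u) when isHStripᵣ (fromMult u) (fromMult v)
        ≈⟨ transfer₀₁≈branchWeight u v ⟨
          transfer₀₁ u v
        ∎
        where
          Y : Carrier
          Y = branchWeight (fromMult v) la when isHStripᵣ la (fromMult v)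
          collapse : ∀ s → isHStripᵣ la (fromMult v) ≡ s → ∑ (λ mu → Y when listEq (fromMult v) mu) candidates ≈ Y
          collapse true strip =
            ∑-listsUpTo-δ (firstPart la) (length la) (fromMult v) Y (isHStripᵣ⇒bounded la (fromMult v) strip)
                          (isHStripᵣ⇒length≤ la (fromMult v) strip (positive-fromMult v))
          collapse false notStrip =
            trans (∑-zero candidates (λ mu → trans (when-cong (listEq (fromMult v) mu) (when-false _ notStrip))
                                                   (0#-when (listEq (fromMult v) mu))))
                  (sym (when-false _ notStrip))

      ∑-strips-transfer : (F : List ℕ → Carrier) (H : Vec ℕ N → Carrier) →
        (∀ mu → stripCondition la mu ≡ true → F mu ≈ H (mult mu N)) →
        ∑ (λ mu → F mu * branchWeight mu la) (strips la) ≈ ∑ (λ v → transfer₀₁ u v * H v) (box u)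
      ∑-strips-transfer F H F≈H = begin
          ∑ (λ mu → F mu * branchWeight mu la) (strips la)
        ≈⟨ ∑-strips-cong expand ⟩
          ∑ (λ mu → ∑ (λ v → X mu v * H v) (box u)) (strips la)
        ≈⟨ ∑-swap (λ mu v → X mu v * H v) (strips la) (box u) ⟩
          ∑ (λ v → ∑ (λ mu → X mu v * H v) (strips la)) (box u)
        ≈⟨ ∑-cong (box u) (λ v → trans (sym (∑-*ʳ (H v) (λ mu → X mu v) (strips la))) (*-cong (∑-strips-δ v) refl)) ⟩
          ∑ (λ v → transfer₀₁ u v * H v) (box u)
        ∎
        where
          X : List ℕ → Vec ℕ N → Carrier
          X mu v = branchWeight mu la * (1# when vecEq v (mult mu N))
          inBox : ∀ mu → stripCondition la mu ≡ true → InBox u (mult mu N)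
          inBox mu c = isHStripᵣ⇒inBox u (mult mu N)
            (P.trans (P.cong₂ isHStripᵣ fromMult-mult-la (fromMult-mult-strip mu c)) (stripCondition⇒isHStripᵣ la mu c))
          select : ∀ w v → H w when vecEq w v ≈ (1# when vecEq v w) * H v
          select w v with vecEq w v in e
          ... | true rewrite vecEq-sym v w | e | vecEq-true⇒≡ w v e = sym (*-identityˡ _)
          ... | false rewrite vecEq-sym v w | e = sym (zeroˡ _)
          expand : ∀ mu → stripCondition la mu ≡ true → F mu * branchWeight mu la ≈ ∑ (λ v → X mu v * H v) (box u)
          expand mu c = begin
              F mu * branchWeight mu la
            ≈⟨ trans (*-cong (F≈H mu c) refl) (*-comm _ _) ⟩
              branchWeight mu la * H (mult mu N)
            ≈⟨ *-cong refl (trans (sym (∑-box-δ u (mult mu N) _ (inBox mu c))) (∑-cong (box u) (select (mult mu N)))) ⟩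
              branchWeight mu la * ∑ (λ v → (1# when vecEq v (mult mu N)) * H v) (box u)
            ≈⟨ ∑-*ˡ _ _ (box u) ⟩
              ∑ (λ v → branchWeight mu la * ((1# when vecEq v (mult mu N)) * H v)) (box u)
            ≈⟨ ∑-cong (box u) (λ v → sym (*-assoc _ _ _)) ⟩
              ∑ (λ v → X mu v * H v) (box u)
            ∎

  module Row (w : Weight R) (rb : ℕ) where

    rowSum : ∀ {N} → Vec ℕ N → (Vec ℕ N → Carrier) → Carrier
    rowSum {N} bs F = ∑ (λ as → proj₁ (row R w rb as bs) * F (proj₂ (row R w rb as bs))) (bits N)

    -- The same row evaluated site by site, with left label c at the first site.
    rowFrom : ℕ → ∀ {N} → Vec ℕ N → (Vec ℕ N → Carrier) → Carrier
    rowFrom c []       F = F [] when (c ≡ᵇ rb)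
    rowFrom c (b ∷ bs) F = w c b 0 (c ℕ.+ b ∸ 0) * rowFrom 0 bs (λ t → F ((c ℕ.+ b ∸ 0) ∷ t))
                         + w c b 1 (c ℕ.+ b ∸ 1) * rowFrom 1 bs (λ t → F ((c ℕ.+ b ∸ 1) ∷ t))

    rowFrom-cong : ∀ c {N} (bs : Vec ℕ N) {F G : Vec ℕ N → Carrier} → (∀ t → F t ≈ G t) → rowFrom c bs F ≈ rowFrom c bs G
    rowFrom-cong c []       e = when-cong (c ≡ᵇ rb) (e [])
    rowFrom-cong c (b ∷ bs) e = +-cong (*-cong refl (rowFrom-cong 0 bs (λ _ → e _))) (*-cong refl (rowFrom-cong 1 bs (λ _ → e _)))

    rowFrom-*ˡ : ∀ c {N} (bs : Vec ℕ N) k (F : Vec ℕ N → Carrier) → rowFrom c bs (λ t → k * F t) ≈ k * rowFrom c bs F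
    rowFrom-*ˡ c []       k F = sym (*-when k _ (c ≡ᵇ rb))
    rowFrom-*ˡ c (b ∷ bs) k F = begin
        w c b 0 _ * rowFrom 0 bs (λ t → k * _) + w c b 1 _ * rowFrom 1 bs (λ t → k * _)
      ≈⟨ +-cong (*-cong refl (rowFrom-*ˡ 0 bs k _)) (*-cong refl (rowFrom-*ˡ 1 bs k _)) ⟩
        w c b 0 _ * (k * rowFrom 0 bs _) + w c b 1 _ * (k * rowFrom 1 bs _)
      ≈⟨ +-cong (*-CS.x∙yz≈y∙xz _ _ _) (*-CS.x∙yz≈y∙xz _ _ _) ⟩
        k * (w c b 0 _ * rowFrom 0 bs _) + k * (w c b 1 _ * rowFrom 1 bs _)
      ≈⟨ distribˡ k _ _ ⟨
        k * rowFrom c (b ∷ bs) F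
      ∎

    ∑-bits : ∀ {N} (f : Vec ℕ (suc N) → Carrier) → ∑ f (bits (suc N)) ≈ ∑ (λ v → f (0 ∷ v) + f (1 ∷ v)) (bits N)
    ∑-bits {N} f = trans (∑-concatMap f _ (bits N)) (∑-cong (bits N) (λ v → +-cong refl (+-identityʳ _)))

    -- Generalised to observables depending on the left boundary label, for the induction.
    rowSum-by-leftLabel : rb ≤ 1 → ∀ {N} (bs : Vec ℕ N) (F : ℕ → Vec ℕ N → Carrier) →
      ∑ (λ as → proj₁ (row R w rb as bs) * F (headOr rb as) (proj₂ (row R w rb as bs))) (bits N)
        ≈ rowFrom 0 bs (F 0) + rowFrom 1 bs (F 1)
    rowSum-by-leftLabel z≤n       []       F = trans (+-identityʳ _) (trans (*-identityˡ _) (sym (+-identityʳ _)))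
    rowSum-by-leftLabel (s≤s z≤n) []       F = trans (+-identityʳ _) (trans (*-identityˡ _) (sym (+-identityˡ _)))
    rowSum-by-leftLabel rb≤1 {suc N} (b ∷ bs) F =
      trans (∑-bits (λ as → proj₁ (row R w rb as (b ∷ bs)) * F (headOr rb as) (proj₂ (row R w rb as (b ∷ bs)))))
            (trans (∑-+ (fromLabel 0) (fromLabel 1) (bits N)) (+-cong (firstSite 0) (firstSite 1)))
      where
        fromLabel : ℕ → Vec ℕ N → Carrier
        fromLabel a as = proj₁ (row R w rb (a ∷ as) (b ∷ bs)) * F a (proj₂ (row R w rb (a ∷ as) (b ∷ bs)))
        firstSite : ∀ a → ∑ (fromLabel a) (bits N) ≈ rowFrom a (b ∷ bs) (F a)
        firstSite a =
          trans (∑-cong (bits N) (λ as → *-CS.xy∙z≈y∙xz _ _ _))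
                (trans (rowSum-by-leftLabel rb≤1 bs (λ c′ t → w a b c′ (a ℕ.+ b ∸ c′) * F a ((a ℕ.+ b ∸ c′) ∷ t)))
                       (+-cong (rowFrom-*ˡ 0 bs _ _) (rowFrom-*ˡ 1 bs _ _)))

    rowSum≈rowFrom : rb ≤ 1 → ∀ {N} (bs : Vec ℕ N) (F : Vec ℕ N → Carrier) → rowSum bs F ≈ rowFrom 0 bs F + rowFrom 1 bs F
    rowSum≈rowFrom rb≤1 bs F = rowSum-by-leftLabel rb≤1 bs (λ _ → F)

  module _ (w : Weight R) (rb : ℕ) where
    open Row w rb

    rowSum-cong : ∀ {N} (bs : Vec ℕ N) {F G : Vec ℕ N → Carrier} → (∀ t → F t ≈ G t) → rowSum bs F ≈ rowSum bs G
    rowSum-cong {N} bs e = ∑-cong (bits N) (λ _ → *-cong refl (e _))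

    rowSum-linear : ∀ {a} {X : Set a} {N} (bs : Vec ℕ N) (L : List X) (k : X → Carrier) (F : X → Vec ℕ N → Carrier) →
                    rowSum bs (λ t → ∑ (λ x → k x * F x t) L) ≈ ∑ (λ x → k x * rowSum bs (F x)) L
    rowSum-linear {N = N} bs L k F = begin
        ∑ (λ as → p as * ∑ (λ x → k x * F x (top as)) L) (bits N)
      ≈⟨ ∑-cong (bits N) (λ as → ∑-*ˡ (p as) _ L) ⟩
        ∑ (λ as → ∑ (λ x → p as * (k x * F x (top as))) L) (bits N)
      ≈⟨ ∑-swap _ (bits N) L ⟩
        ∑ (λ x → ∑ (λ as → p as * (k x * F x (top as))) (bits N)) L
      ≈⟨ ∑-cong L (λ x → trans (∑-cong (bits N) (λ as → *-CS.x∙yz≈y∙xz _ _ _)) (sym (∑-*ˡ (k x) _ (bits N)))) ⟩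
        ∑ (λ x → k x * rowSum bs (F x)) L
      ∎
      where
        p : Vec ℕ N → Carrier
        p = λ as → proj₁ (row R w rb as bs)
        top : Vec ℕ N → Vec ℕ N
        top = λ as → proj₂ (row R w rb as bs)

  -- The partition function of a stack of rows with an arbitrary observable
  -- of the top labels in place of the indicator of prescribed top labels.
  stackWith : List (Weight R) → ℕ → ∀ {N} → Vec ℕ N → (Vec ℕ N → Carrier) → Carrier
  stackWith []       rb bot f = f bot
  stackWith (w ∷ ws) rb bot f = Row.rowSum w rb bot (λ v → stackWith ws rb v f)

  stackWith-cong : ∀ ws rb {N} (bot : Vec ℕ N) {f g : Vec ℕ N → Carrier} → (∀ v → f v ≈ g v) →
                   stackWith ws rb bot f ≈ stackWith ws rb bot g
  stackWith-cong []       rb bot e = e bot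
  stackWith-cong (w ∷ ws) rb bot e = rowSum-cong w rb bot (λ v → stackWith-cong ws rb v e)

  stack≈stackWith : ∀ ws rb {N} (bot top : Vec ℕ N) → stack R ws rb bot top ≈ stackWith ws rb bot (λ v → 1# when vecEq v top)
  stack≈stackWith []       rb bot top = refl
  stack≈stackWith (w ∷ ws) rb bot top = rowSum-cong w rb bot (λ v → stack≈stackWith ws rb v top)

  stackWith-∷ʳ : ∀ ws w rb {N} (bot : Vec ℕ N) f →
                 stackWith (ws ++ w ∷ []) rb bot f ≈ stackWith ws rb bot (λ v → Row.rowSum w rb v f)
  stackWith-∷ʳ []       w rb bot f = refl
  stackWith-∷ʳ (w′ ∷ ws) w rb bot f = rowSum-cong w′ rb bot (λ v → stackWith-∷ʳ ws w rb v f)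

  stackWith-linear : ∀ {a} {X : Set a} ws rb {N} (bot : Vec ℕ N) (L : List X) (k : X → Carrier) (f : X → Vec ℕ N → Carrier) →
                     stackWith ws rb bot (λ v → ∑ (λ x → k x * f x v) L) ≈ ∑ (λ x → k x * stackWith ws rb bot (f x)) L
  stackWith-linear []       rb bot L k f = refl
  stackWith-linear (w ∷ ws) rb bot L k f =
    trans (rowSum-cong w rb bot (λ v → stackWith-linear ws rb v L k f))
          (rowSum-linear w rb bot L k (λ x v → stackWith ws rb v (f x)))

  -- The two lattices in terms of the transfer matrix

  module Models (A B : Carrier) where
    open Transfer A B

    private
      A-weight : ∀ b → vertexWeight 1 b ≈ A
      A-weight b = trans (*-identityʳ _) (*-identityʳ _)
      B-weight : ∀ m → vertexWeight 0 (suc m) ≈ B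
      B-weight m = trans (*-identityˡ _) (*-identityʳ _)
      1-weight : vertexWeight 0 0 ≈ 1#
      1-weight = *-identityˡ 1#

    colWeight≈wZ : ∀ k k′ → k ≤ 1 → k′ ≤ 1 → ∀ a b →
                   colWeight k a b k′ ≈ wZ R A B k b k′ (k ℕ.+ b ∸ k′) when (k ℕ.+ b ∸ k′ ≡ᵇ a)
    colWeight≈wZ zero zero _ _ a zero = when-cong⇒ _ _ (≡ᵇ-sym a 0) (λ _ → 1-weight)
    colWeight≈wZ zero zero _ _ a (suc m) rewrite ≡ᵇ-refl m = when-cong⇒ _ _ (≡ᵇ-sym a (suc m)) (λ _ → B-weight m)
    colWeight≈wZ zero (suc zero) _ _ a zero = sym (0#-when (0 ≡ᵇ a))
    colWeight≈wZ zero (suc zero) _ _ a (suc m) rewrite ≡ᵇ-refl m = when-cong⇒ _ _ (≡ᵇ-sym a m) (λ _ → B-weight m)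
    colWeight≈wZ (suc zero) zero _ _ a b rewrite ≡ᵇ-refl b = when-cong⇒ _ _ (≡ᵇ-sym a (suc b)) (λ _ → A-weight b)
    colWeight≈wZ (suc zero) (suc zero) _ _ a b rewrite ≡ᵇ-refl b = when-cong⇒ _ _ (≡ᵇ-sym a b) (λ _ → A-weight b)
    colWeight≈wZ (suc (suc k)) _ (s≤s ()) _ a b
    colWeight≈wZ k (suc (suc k′)) _ (s≤s ()) a b

    colWeight≈wZ* : ∀ c c′ → c ≤ 1 → c′ ≤ 1 → ∀ a b →
                    colWeight (1 ∸ c) a b (1 ∸ c′) ≈ wZ* R A B c a c′ (c ℕ.+ a ∸ c′) when (b ≡ᵇ c ℕ.+ a ∸ c′)
    colWeight≈wZ* zero zero _ _ a b rewrite ≡ᵇ-refl a = when-cong⇒ _ _ (≡ᵇ-sym a b) (λ _ → A-weight b)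
    colWeight≈wZ* zero (suc zero) _ _ zero b = sym (0#-when (b ≡ᵇ 0))
    colWeight≈wZ* zero (suc zero) _ _ (suc m) b rewrite ≡ᵇ-refl m = when-cong⇒ _ _ (≡ᵇ-sym m b) (λ _ → A-weight b)
    colWeight≈wZ* (suc zero) zero _ _ zero b = when-cong⇒ _ _ (≡ᵇ-sym 1 b)
      (λ e → P.subst (λ z → vertexWeight 0 z ≈ B) (≡ᵇ-true⇒≡ 1 b e) (B-weight 0))
    colWeight≈wZ* (suc zero) zero _ _ (suc m) b rewrite ≡ᵇ-refl m = when-cong⇒ _ _ (≡ᵇ-sym (suc (suc m)) b)
      (λ e → P.subst (λ z → vertexWeight 0 z ≈ B) (≡ᵇ-true⇒≡ (suc (suc m)) b e) (B-weight (suc m)))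
    colWeight≈wZ* (suc zero) (suc zero) _ _ zero b = when-cong⇒ _ _ (≡ᵇ-sym 0 b)
      (λ e → P.subst (λ z → vertexWeight 0 z ≈ 1#) (≡ᵇ-true⇒≡ 0 b e) 1-weight)
    colWeight≈wZ* (suc zero) (suc zero) _ _ (suc m) b rewrite ≡ᵇ-refl m = when-cong⇒ _ _ (≡ᵇ-sym (suc m) b)
      (λ e → P.subst (λ z → vertexWeight 0 z ≈ B) (≡ᵇ-true⇒≡ (suc m) b e) (B-weight m))
    colWeight≈wZ* (suc (suc c)) _ (s≤s ()) _ a b
    colWeight≈wZ* c (suc (suc c′)) _ (s≤s ()) a b

    module RowZ = Row (wZ R A B) 0
    module RowZ* = Row (wZ* R A B) 1

    rowZ≈transfer : ∀ k → k ≤ 1 → ∀ {N} (u v : Vec ℕ N) → RowZ.rowFrom k v (λ t → 1# when vecEq t u) ≈ transfer k u v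
    rowZ≈transfer k k≤1 []      []      = refl
    rowZ≈transfer k k≤1 (a ∷ u) (b ∷ v) = +-cong (site 0 z≤n) (site 1 (s≤s z≤n))
      where
        site : ∀ k′ → k′ ≤ 1 →
          wZ R A B k b k′ (k ℕ.+ b ∸ k′) * RowZ.rowFrom k′ v (λ t → 1# when vecEq ((k ℕ.+ b ∸ k′) ∷ t) (a ∷ u))
          ≈ colWeight k a b k′ * transfer k′ u v
        site k′ k′≤1 = begin
            W * RowZ.rowFrom k′ v (λ t → 1# when ((d ≡ᵇ a) ∧ vecEq t u))
          ≈⟨ *-cong refl (RowZ.rowFrom-cong k′ v (λ t → 1#-when-∧ (d ≡ᵇ a) (vecEq t u))) ⟩
            W * RowZ.rowFrom k′ v (λ t → (1# when (d ≡ᵇ a)) * (1# when vecEq t u))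
          ≈⟨ *-cong refl (trans (RowZ.rowFrom-*ˡ k′ v _ _) (*-cong refl (rowZ≈transfer k′ k′≤1 u v))) ⟩
            W * ((1# when (d ≡ᵇ a)) * transfer k′ u v)
          ≈⟨ sym (*-assoc _ _ _) ⟩
            (W * (1# when (d ≡ᵇ a))) * transfer k′ u v
          ≈⟨ *-cong (trans (*-1#-when W (d ≡ᵇ a)) (sym (colWeight≈wZ k k′ k≤1 k′≤1 a b))) refl ⟩
            colWeight k a b k′ * transfer k′ u v
          ∎
          where
            d : ℕ
            d = k ℕ.+ b ∸ k′
            W : Carrier
            W = wZ R A B k b k′ d

    rowZ*≈transfer : ∀ c → c ≤ 1 → ∀ {N} (u : Vec ℕ N) (H : Vec ℕ N → Carrier) →
                     RowZ*.rowFrom c u H ≈ ∑ (λ v → transfer (1 ∸ c) u v * H v) (box u)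
    rowZ*≈transfer zero       _ [] H = sym (trans (+-identityʳ _) (zeroˡ _))
    rowZ*≈transfer (suc zero) _ [] H = sym (trans (+-identityʳ _) (*-identityˡ _))
    rowZ*≈transfer (suc (suc c)) (s≤s ()) [] H
    rowZ*≈transfer c c≤1 (a ∷ u) H = sym (begin
        ∑ (λ v → transfer (1 ∸ c) (a ∷ u) v * H v) (box (a ∷ u))
      ≈⟨ ∑-box _ a u ⟩
        ∑ (λ v → ∑ (λ b → transfer (1 ∸ c) (a ∷ u) (b ∷ v) * H (b ∷ v)) (upTo (suc (suc a)))) (box u)
      ≈⟨ ∑-cong (box u) firstColumn ⟩
        ∑ (λ v → W₁ * (transfer 0 u v * H (d₁ ∷ v)) + W₀ * (transfer 1 u v * H (d₀ ∷ v))) (box u)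
      ≈⟨ ∑-+ _ _ (box u) ⟩
        ∑ (λ v → W₁ * (transfer 0 u v * H (d₁ ∷ v))) (box u) + ∑ (λ v → W₀ * (transfer 1 u v * H (d₀ ∷ v))) (box u)
      ≈⟨ +-comm _ _ ⟩
        ∑ (λ v → W₀ * (transfer 1 u v * H (d₀ ∷ v))) (box u) + ∑ (λ v → W₁ * (transfer 0 u v * H (d₁ ∷ v))) (box u)
      ≈⟨ +-cong (∑-*ˡ W₀ _ (box u)) (∑-*ˡ W₁ _ (box u)) ⟨
        W₀ * ∑ (λ v → transfer 1 u v * H (d₀ ∷ v)) (box u) + W₁ * ∑ (λ v → transfer 0 u v * H (d₁ ∷ v)) (box u)
      ≈⟨ +-cong (*-cong refl (rowZ*≈transfer 0 z≤n u _)) (*-cong refl (rowZ*≈transfer 1 (s≤s z≤n) u _)) ⟨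
        RowZ*.rowFrom c (a ∷ u) H
      ∎)
      where
        d₀ d₁ : ℕ
        d₀ = c ℕ.+ a ∸ 0
        d₁ = c ℕ.+ a ∸ 1
        W₀ W₁ : Carrier
        W₀ = wZ* R A B c a 0 d₀
        W₁ = wZ* R A B c a 1 d₁
        d₀<a+2 : d₀ < suc (suc a)
        d₀<a+2 = s≤s (ℕ.+-monoˡ-≤ a c≤1)
        d₁<a+2 : d₁ < suc (suc a)
        d₁<a+2 = ℕ.≤-<-trans (ℕ.m∸n≤m (c ℕ.+ a) 1) d₀<a+2
        firstColumn : ∀ v → ∑ (λ b → transfer (1 ∸ c) (a ∷ u) (b ∷ v) * H (b ∷ v)) (upTo (suc (suc a)))
                            ≈ W₁ * (transfer 0 u v * H (d₁ ∷ v)) + W₀ * (transfer 1 u v * H (d₀ ∷ v))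
        firstColumn v = begin
            ∑ (λ b → (colWeight (1 ∸ c) a b 0 * transfer 0 u v + colWeight (1 ∸ c) a b 1 * transfer 1 u v) * H (b ∷ v)) bs
          ≈⟨ ∑-cong bs (λ b → trans (distribʳ _ _ _) (+-cong
               (trans (*-assoc _ _ _) (*-cong (colWeight≈wZ* c 1 c≤1 (s≤s z≤n) a b) refl))
               (trans (*-assoc _ _ _) (*-cong (colWeight≈wZ* c 0 c≤1 z≤n a b) refl)))) ⟩
            ∑ (λ b → (W₁ when (b ≡ᵇ d₁)) * (transfer 0 u v * H (b ∷ v)) + (W₀ when (b ≡ᵇ d₀)) * (transfer 1 u v * H (b ∷ v))) bs
          ≈⟨ ∑-+ _ _ bs ⟩
            ∑ (λ b → (W₁ when (b ≡ᵇ d₁)) * (transfer 0 u v * H (b ∷ v))) bs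
              + ∑ (λ b → (W₀ when (b ≡ᵇ d₀)) * (transfer 1 u v * H (b ∷ v))) bs
          ≈⟨ +-cong (∑-upTo-collapse _ d₁ W₁ (λ b → transfer 0 u v * H (b ∷ v)) d₁<a+2)
                    (∑-upTo-collapse _ d₀ W₀ (λ b → transfer 1 u v * H (b ∷ v)) d₀<a+2) ⟩
            W₁ * (transfer 0 u v * H (d₁ ∷ v)) + W₀ * (transfer 1 u v * H (d₀ ∷ v))
          ∎
          where bs = upTo (suc (suc a))

  G₀ : ∀ β (xs us : Fin 0 → Carrier) N la → isPartition la ≡ true → firstPart la ≤ N →
       G R β 0 xs us la ≈ 1# when vecEq (mult la N) (replicate N 0)
  G₀ β xs us N []       _   _   = sym (when-true 1# (vecEq-mult-[] N))
  G₀ β xs us N (x ∷ la) isP la≤N with vecEq (mult (x ∷ la) N) (replicate N 0) in e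
  ... | false = refl
  ... | true with () ← P.trans (P.sym (fromMult-mult N (x ∷ la) isP la≤N))
                               (P.trans (P.cong fromMult (vecEq-true⇒≡ (mult (x ∷ la) N) (replicate N 0) e)) (fromMult-replicate-0 N))

  module _ (β : Carrier) where

    private
      boundedStrip : ∀ {N} la mu → firstPart la ≤ N → stripCondition la mu ≡ true → firstPart mu ≤ N
      boundedStrip la mu la≤N c = ℕ.≤-trans (stripCondition⇒firstPart≤ la mu c) la≤N

    G≈Z* : ∀ n (xs us : Fin n → Carrier) N la → isPartition la ≡ true → firstPart la ≤ N →
           G R β n xs us la ≈ Z* R β n xs us N la
    G≈Z* zero    xs us N la isP la≤N = G₀ β xs us N la isP la≤N
    G≈Z* (suc n) xs us N la isP la≤N = begin
        ∑ (λ mu → G R β n xs′ us′ mu * branchWeight mu la) (strips la)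
      ≈⟨ ∑-strips-transfer la isP la≤N (G R β n xs′ us′) H
           (λ mu c → G≈Z* n xs′ us′ N mu (stripCondition⇒isPartition la mu c) (boundedStrip la mu la≤N c)) ⟩
        ∑ (λ v → transfer₀₁ u v * H v) (box u)
      ≈⟨ trans (∑-cong (box u) (λ v → distribʳ (H v) _ _)) (∑-+ _ _ (box u)) ⟩
        ∑ (λ v → transfer 0 u v * H v) (box u) + ∑ (λ v → transfer 1 u v * H v) (box u)
      ≈⟨ trans (+-comm _ _) (sym (+-cong (rowZ*≈transfer 0 z≤n u H) (rowZ*≈transfer 1 (s≤s z≤n) u H))) ⟩
        RowZ*.rowFrom 0 u H + RowZ*.rowFrom 1 u H
      ≈⟨ RowZ*.rowSum≈rowFrom (s≤s z≤n) u H ⟨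
        RowZ*.rowSum u H
      ≡⟨ P.cong (λ ws → stack R ws 1 u (replicate N 0)) (P.sym (map-reverse-allFin-suc n g)) ⟩
        Z* R β (suc n) xs us N la
      ∎
      where
        xs′ us′ : Fin n → Carrier
        xs′ = xs ∘ inject₁
        us′ = us ∘ inject₁
        x y : Carrier
        x = xs (fromℕ n)
        y = us (fromℕ n)
        open Transfer (fracA R x y) (fracB R β x y)
        open Models (fracA R x y) (fracB R β x y)
        g : Fin (suc n) → Weight R
        g i = wZ* R (fracA R (xs i) (us i)) (fracB R β (xs i) (us i))
        u : Vec ℕ N
        u = mult la N
        H : Vec ℕ N → Carrier
        H v = stack R (map (g ∘ inject₁) (reverse (allFin n))) 1 v (replicate N 0)

    G≈Z : ∀ n (xs us : Fin n → Carrier) N la → isPartition la ≡ true → firstPart la ≤ N →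
          G R β n xs us la ≈ Z R β n xs us N la
    G≈Z zero    xs us N la isP la≤N =
      trans (G₀ β xs us N la isP la≤N) (reflexive (P.cong (1# when_) (vecEq-sym (mult la N) (replicate N 0))))
    G≈Z (suc n) xs us N la isP la≤N = begin
        ∑ (λ mu → G R β n xs′ us′ mu * branchWeight mu la) (strips la)
      ≈⟨ ∑-strips-cong la isP la≤N (λ mu c → trans (*-cong (IH mu c) refl) (*-comm _ _)) ⟩
        ∑ (λ mu → branchWeight mu la * stack R ws 0 zeros (mult mu N)) (strips la)
      ≈⟨ ∑-cong (strips la) (λ mu → *-cong refl (stack≈stackWith ws 0 zeros (mult mu N))) ⟩
        ∑ (λ mu → branchWeight mu la * stackWith ws 0 zeros (λ v → 1# when vecEq v (mult mu N))) (strips la)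
      ≈⟨ stackWith-linear ws 0 zeros (strips la) (λ mu → branchWeight mu la) (λ mu v → 1# when vecEq v (mult mu N)) ⟨
        stackWith ws 0 zeros (λ v → ∑ (λ mu → branchWeight mu la * (1# when vecEq v (mult mu N))) (strips la))
      ≈⟨ stackWith-cong ws 0 zeros (∑-strips-δ la isP la≤N) ⟩
        stackWith ws 0 zeros (transfer₀₁ u)
      ≈⟨ stackWith-cong ws 0 zeros topRow ⟨
        stackWith ws 0 zeros (λ v → RowZ.rowSum v (λ t → 1# when vecEq t u))
      ≈⟨ stackWith-∷ʳ ws (g (fromℕ n)) 0 zeros _ ⟨
        stackWith (ws ∷ʳ g (fromℕ n)) 0 zeros (λ t → 1# when vecEq t u)
      ≈⟨ stack≈stackWith (ws ∷ʳ g (fromℕ n)) 0 zeros u ⟨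
        stack R (ws ∷ʳ g (fromℕ n)) 0 zeros u
      ≡⟨ P.cong (λ ws → stack R ws 0 zeros u) (P.sym (map-allFin-suc n g)) ⟩
        Z R β (suc n) xs us N la
      ∎
      where
        xs′ us′ : Fin n → Carrier
        xs′ = xs ∘ inject₁
        us′ = us ∘ inject₁
        x y : Carrier
        x = xs (fromℕ n)
        y = us (fromℕ n)
        open Transfer (fracA R x y) (fracB R β x y)
        open Models (fracA R x y) (fracB R β x y)
        g : Fin (suc n) → Weight R
        g i = wZ R (fracA R (xs i) (us i)) (fracB R β (xs i) (us i))
        ws : List (Weight R)
        ws = map (g ∘ inject₁) (allFin n)
        zeros u : Vec ℕ N
        zeros = replicate N 0
        u = mult la N
        IH : ∀ mu → stripCondition la mu ≡ true → G R β n xs′ us′ mu ≈ stack R ws 0 zeros (mult mu N)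
        IH mu c = G≈Z n xs′ us′ N mu (stripCondition⇒isPartition la mu c) (boundedStrip la mu la≤N c)
        topRow : ∀ v → RowZ.rowSum v (λ t → 1# when vecEq t u) ≈ transfer₀₁ u v
        topRow v = trans (RowZ.rowSum≈rowFrom z≤n v _) (+-cong (rowZ≈transfer 0 z≤n u v) (rowZ≈transfer 1 (s≤s z≤n) u v))


theorem2p1 : ∀ {c ℓ} (R : CommutativeRing c ℓ) →
    let open CommutativeRing R in
    (α β : Carrier) (n : ℕ) → 1 ≤ n →
    (xs us : Fin n → Carrier) → (∀ i → (1# + - (α * xs i)) * us i ≈ 1#) →
    (la : List ℕ) → T (isPartition la) →
    (N : ℕ) → firstPart la ≤ N →
    (G R β n xs us la ≈ Z R β n xs us N la) × (Z R β n xs us N la ≈ Z* R β n xs us N la)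
-- Everything is a formal identity in A = x·u and B = (1 + βx)·u.
theorem2p1 R α β n _ xs us _ la isP N la≤N =
  G≈Z β n xs us N la isPartition-la la≤N ,
  trans (sym (G≈Z β n xs us N la isPartition-la la≤N)) (G≈Z* β n xs us N la isPartition-la la≤N)
  where
    open CommutativeRing R using (trans; sym)
    open PartitionFunctions R
    isPartition-la : isPartition la ≡ true
    isPartition-la = Partitions.T⇒≡true isP
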